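{- (1) In the non-deterministic bang calculus, with $\to\,=\,\to_\oplus\cup\to_{!\beta}$, least-level factorization holds: $\to^*\subseteq\to_{\ell\ell}^*\cdot\to_{\neg\ell\ell}^*$. (2) Least-level factorization holds in the non-deterministic CbN calculus $(\Lambda_\oplus,\to_\oplus\cup\to_\beta)$ and in the non-deterministic CbV calculus $(\Lambda_\oplus,\to_\oplus\cup\to_{\beta_v})$.
   Context: $\oplus$ is a binary operator. $\lambda$-terms $t ::= x\mid\lambda x.t\mid ts\mid\oplus(t_1,t_2)$ (set $\Lambda_\oplus$; values = variables and abstractions), contexts $c ::= [\cdot]\mid tc\mid ct\mid\lambda x.c\mid\oplus(c,t)\mid\oplus(t,c)$. Bang terms $T ::= x\mid\lambda x.T\mid TS\mid !T\mid\oplus(T_1,T_2)$, contexts $C ::= [\cdot]\mid\lambda x.C\mid TC\mid CT\mid !C\mid\oplus(C,T)\mid\oplus(T,C)$. Rules (contextually closed): $(\lambda x.t)s\mapsto_\beta t[s/x]$; $(\lambda x.t)v\mapsto_{\beta_v}t[v/x]$ ($v$ value); $(\lambda x.T)\,!S\mapsto_{!\beta}T[S/x]$; $\oplus(P,Q)\mapsto_\oplus P$ and $\oplus(P,Q)\mapsto_\oplus Q$ (on both kinds of terms). Levels of contexts: bang: $0$ at hole, $+1$ under $!$ and under $\oplus$, unchanged under $\lambda$ and application; CbN: $0$ at hole, unchanged under $\lambda x.c$ and $ct$, $+1$ under $tc$ and under $\oplus$; CbV: $0$ at hole, $+1$ under $\lambda x.c$, level of $ct$ equals that of $c'$ if $c=\lambda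 x.c'$ and that of $c$ otherwise, unchanged under $tc$, $+1$ under $\oplus$. In each calculus, the least level of a term is the infimum (in $\mathbb{N}\cup\{\infty\}$) of the levels of $C$ over decompositions $C[R]$ with $R$ a redex of the calculus' reduction (the $\oplus$-redexes together with the $!\beta$-, $\beta$-, resp. $\beta_v$-redexes); a step $C[R]\to C[R']$ is least-level ($\to_{\ell\ell}$) if the level of $C$ equals the least level of $C[R]$ and internal ($\to_{\neg\ell\ell}$) if strictly greater. Least-level factorization means $\to^*\subseteq\to_{\ell\ell}^*\cdot\to_{\neg\ell\ell}^*$ ($\cdot$ composition). -}

module Defs where

open import Data.Nat using (ℕ; zero; suc; _≤_; _<_; _<ᵇ_; _≡ᵇ_; pred)
open import Data.Bool using (if_then_else_)
open import Data.Product using (Σ; _×_; ∃; ∃-syntax; _,_)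
open import Relation.Binary.PropositionalEquality using (_≡_)
open import Relation.Binary.Construct.Closure.ReflexiveTransitive using (Star)

module Calculus {T C : Set} (plug : C → T → T) (level : C → ℕ)
                (root : T → T → Set) where

  record Decomp (t : T) : Set where
    constructor decomp
    field
      ctx     : C
      redex   : T
      reduct  : T
      isRoot  : root redex reduct
      plugEq  : t ≡ plug ctx redex

  -- a step C[R] → C[R'] ; the context is recorded so its level is known
  record StepVia (t u : T) : Set where
    constructor stepVia
    field
      ctx     : C
      redex   : T
      reduct  : T
      isRoot  : root redex reduct
      srcEq   : t ≡ plug ctx redex
      tgtEq   : u ≡ plug ctx reduct

  open StepVia public

  Step : T → T → Set
  Step t u = StepVia t u

  -- the least level of t is the infimum of the levels of C over the
  -- decompositions C[R]; "level C equals the infimum" for an attained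
  -- level C means level C is a lower bound of all those levels.
  LLStep : T → T → Set
  LLStep t u = Σ (StepVia t u) λ s →
    (d : Decomp t) → level (ctx s) ≤ level (Decomp.ctx d)

  -- internal: level C strictly greater than the infimum, i.e. some
  -- decomposition of t has a strictly smaller level.
  IntStep : T → T → Set
  IntStep t u = Σ (StepVia t u) λ s →
    Σ (Decomp t) λ d → level (Decomp.ctx d) < level (ctx s)

  LeastLevelFactorization : Set
  LeastLevelFactorization =
    ∀ {t u} → Star Step t u → ∃[ s ] (Star LLStep t s × Star IntStep s u)

data BTerm : Set where
  var   : ℕ → BTerm
  lam   : BTerm → BTerm
  app   : BTerm → BTerm → BTerm
  bang  : BTerm → BTerm
  oplus : BTerm → BTerm → BTerm

bshift : ℕ → BTerm → BTerm
bshift c (var x)     = if x <ᵇ c then var x else var (suc x)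
bshift c (lam t)     = lam (bshift (suc c) t)
bshift c (app t s)   = app (bshift c t) (bshift c s)
bshift c (bang t)    = bang (bshift c t)
bshift c (oplus t s) = oplus (bshift c t) (bshift c s)

-- bsubst k s t : replace variable k by s (s already lifted to depth k),
-- decrementing the free variables above k
bsubst : ℕ → BTerm → BTerm → BTerm
bsubst k s (var x)     = if x <ᵇ k then var x else (if x ≡ᵇ k then s else var (pred x))
bsubst k s (lam t)     = lam (bsubst (suc k) (bshift 0 s) t)
bsubst k s (app t u)   = app (bsubst k s t) (bsubst k s u)
bsubst k s (bang t)    = bang (bsubst k s t)
bsubst k s (oplus t u) = oplus (bsubst k s t) (bsubst k s u)

-- T[S/x] where x is the variable bound by the enclosing λ (index 0)
_B[_] : BTerm → BTerm → BTerm
t B[ s ] = bsubst 0 s t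

data BCtx : Set where
  hole    : BCtx
  lamC    : BCtx → BCtx
  appR    : BTerm → BCtx → BCtx
  appL    : BCtx → BTerm → BCtx
  bangC   : BCtx → BCtx
  oplusL  : BCtx → BTerm → BCtx
  oplusR  : BTerm → BCtx → BCtx

bplug : BCtx → BTerm → BTerm
bplug hole         r = r
bplug (lamC c)     r = lam (bplug c r)
bplug (appR t c)   r = app t (bplug c r)
bplug (appL c t)   r = app (bplug c r) t
bplug (bangC c)    r = bang (bplug c r)
bplug (oplusL c t) r = oplus (bplug c r) t
bplug (oplusR t c) r = oplus t (bplug c r)

blevel : BCtx → ℕ
blevel hole         = 0
blevel (lamC c)     = blevel c
blevel (appR t c)   = blevel c
blevel (appL c t)   = blevel c
blevel (bangC c)    = suc (blevel c)
blevel (oplusL c t) = suc (blevel c)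
blevel (oplusR t c) = suc (blevel c)

data BRoot : BTerm → BTerm → Set where
  !β  : ∀ t s → BRoot (app (lam t) (bang s)) (t B[ s ])
  ⊕₁  : ∀ p q → BRoot (oplus p q) p
  ⊕₂  : ∀ p q → BRoot (oplus p q) q

module Bang = Calculus bplug blevel BRoot

data Term : Set where
  var   : ℕ → Term
  lam   : Term → Term
  app   : Term → Term → Term
  oplus : Term → Term → Term

shift : ℕ → Term → Term
shift c (var x)     = if x <ᵇ c then var x else var (suc x)
shift c (lam t)     = lam (shift (suc c) t)
shift c (app t s)   = app (shift c t) (shift c s)
shift c (oplus t s) = oplus (shift c t) (shift c s)

subst : ℕ → Term → Term → Term
subst k s (var x)     = if x <ᵇ k then var x else (if x ≡ᵇ k then s else var (pred x))
subst k s (lam t)     = lam (subst (suc k) (shift 0 s) t)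
subst k s (app t u)   = app (subst k s t) (subst k s u)
subst k s (oplus t u) = oplus (subst k s t) (subst k s u)

_[_] : Term → Term → Term
t [ s ] = subst 0 s t

data Value : Term → Set where
  var : ∀ x → Value (var x)
  lam : ∀ t → Value (lam t)

data Ctx : Set where
  hole    : Ctx
  lamC    : Ctx → Ctx
  appR    : Term → Ctx → Ctx
  appL    : Ctx → Term → Ctx
  oplusL  : Ctx → Term → Ctx
  oplusR  : Term → Ctx → Ctx

plug : Ctx → Term → Term
plug hole         r = r
plug (lamC c)     r = lam (plug c r)
plug (appR t c)   r = app t (plug c r)
plug (appL c t)   r = app (plug c r) t
plug (oplusL c t) r = oplus (plug c r) t
plug (oplusR t c) r = oplus t (plug c r)

nlevel : Ctx → ℕ
nlevel hole         = 0
nlevel (lamC c)     = nlevel c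
nlevel (appL c t)   = nlevel c
nlevel (appR t c)   = suc (nlevel c)
nlevel (oplusL c t) = suc (nlevel c)
nlevel (oplusR t c) = suc (nlevel c)

vlevel : Ctx → ℕ
vlevel hole                = 0
vlevel (lamC c)            = suc (vlevel c)
vlevel (appL (lamC c') t)  = vlevel c'
vlevel (appL c t)          = vlevel c
vlevel (appR t c)          = vlevel c
vlevel (oplusL c t)        = suc (vlevel c)
vlevel (oplusR t c)        = suc (vlevel c)

data NRoot : Term → Term → Set where
  β   : ∀ t s → NRoot (app (lam t) s) (t [ s ])
  ⊕₁  : ∀ p q → NRoot (oplus p q) p
  ⊕₂  : ∀ p q → NRoot (oplus p q) q

data VRoot : Term → Term → Set where
  βv  : ∀ t v → Value v → VRoot (app (lam t) v) (t [ v ])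
  ⊕₁  : ∀ p q → VRoot (oplus p q) p
  ⊕₂  : ∀ p q → VRoot (oplus p q) q

module CbN = Calculus plug nlevel NRoot
module CbV = Calculus plug vlevel VRoot

module Submission where

-- Each calculus gets a parallel reduction Par k contracting only redexes at levels ≥ k. A Par k
-- step splits into level-k steps followed by a Par (k+1) step, and a Par (k+1) step followed by a
-- level-k step merges into a single Par k step. Internal steps neither create redexes below the
-- least level nor erase those at it, so the least level is invariant along them; hence a
-- least-level step after an internal parallel step can be merged into it and split off again,
-- which moves all least-level steps to the front (the recursion on levels stops at the depth of
-- the target). Boxing arguments embeds CbN into the bang calculus preserving levels and reflecting
-- steps, so CbN inherits factorization; for CbV, where ⊕ in function position defeats such an
-- embedding, the argument is carried out directly.

open import Defs
open import Data.Bool using (true; false; if_then_else_)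
open import Data.Nat using (ℕ; zero; suc; pred; _≤_; _<_; _+_; _⊔_; _≤′_; ≤′-refl; ≤′-step; z≤n; s≤s; s≤s⁻¹; _<ᵇ_; _≡ᵇ_)
open import Data.Nat.Properties
  using (≤-refl; ≤-trans; <⇒≤; ≤-antisym; ≤-pred; ≤∧≢⇒<; ≤⇒≤′; m<n⇒m<1+n; n<1+n; +-identityʳ; +-suc; m≤n+m; m⊔n<o⇒m<o; m⊔n<o⇒n<o)
open import Data.Product using (Σ; ∃; ∃-syntax; _×_; _,_; map)
open import Data.Sum using (_⊎_; inj₁; inj₂)
open import Function using (id; _∘_)
open import Relation.Nullary using (Dec; yes; no)
open import Relation.Nullary.Decidable using (map′)
open import Relation.Binary.PropositionalEquality as ≡ using (_≡_; refl; sym; trans; cong; cong₂; _≗_; module ≡-Reasoning)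
open import Relation.Binary.Construct.Closure.ReflexiveTransitive using (Star; ε; _◅_; _◅◅_; gmap)

pred≤⇒≤suc : ∀ {k l} → pred k ≤ l → k ≤ suc l
pred≤⇒≤suc {zero}  _   = z≤n
pred≤⇒≤suc {suc k} k≤l = s≤s k≤l

module LeastLevel {Term : Set} (Step : ℕ → Term → Term → Set) where

  open import Relation.Binary.Construct.Closure.Reflexive using (ReflClosure; [_]) renaming (refl to refl⁼)

  private variable
    j k l m : ℕ
    t u w : Term

  RedexAt : ℕ → Term → Set
  RedexAt l t = ∃ (Step l t)

  NoRedexBelow : ℕ → Term → Set
  NoRedexBelow k t = ∀ {j} → RedexAt j t → k ≤ j

  _⟶_ _⟶ℓℓ_ _⟶¬ℓℓ_ : Term → Term → Set
  t ⟶ u = ∃[ l ] Step l t u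
  t ⟶ℓℓ u = ∃[ l ] (Step l t u × NoRedexBelow l t)
  t ⟶¬ℓℓ u = ∃[ l ] ∃[ m ] (Step l t u × RedexAt m t × m < l)

  Factorizes : Set
  Factorizes = ∀ {t u} → Star _⟶_ t u → ∃[ s ] (Star _⟶ℓℓ_ t s × Star _⟶¬ℓℓ_ s u)

  StepFrom : ℕ → Term → Term → Set
  StepFrom k t u = ∃[ l ] (k ≤ l × Step l t u)

  stepsFrom-map : ∀ {k k′} {C : Term → Term} (f : ℕ → ℕ) → (∀ {l} → k ≤ l → k′ ≤ f l)
                → (∀ {l t u} → Step l t u → Step (f l) (C t) (C u))
                → Star (StepFrom k) t u → Star (StepFrom k′) (C t) (C u)
  stepsFrom-map f mono ξ = gmap _ λ (l , k≤l , st) → f l , mono k≤l , ξ st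

  record MacroSteps : Set₁ where
    field
      Par                   : ℕ → Term → Term → Set
      depth                 : Term → ℕ
      redexAt?              : ∀ k t → Dec (RedexAt k t)
      step-keeps-redexAt    : Step l t u → m < l → RedexAt m t → RedexAt m u
      step-keeps-noRedexBelow : Step l t u → m ≤ l → NoRedexBelow m t → NoRedexBelow m u
      step⇒par              : Step l t u → Par l t u
      par-antitone          : j ≤ k → Par k t u → Par j t u
      par⇒steps             : Par k t u → Star (StepFrom k) t u
      par-trivial           : Par k t u → depth u < k → t ≡ u
      par-split             : Par k t u → ∃[ s ] (Star (Step k) t s × Par (suc k) s u)
      par-merge             : Par (suc k) t u → Step k u w → Par k t w

  module Factorization (M : MacroSteps) where
    open MacroSteps M

    _⇒¬ℓℓ_ : Term → Term → Set
    t ⇒¬ℓℓ u = ∃[ m ] (RedexAt m t × NoRedexBelow m t × Par (suc m) t u)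

    least-redex-level : ∀ l t → NoRedexBelow l t ⊎ ∃[ m ] (m < l × RedexAt m t × NoRedexBelow m t)
    least-redex-level zero    t = inj₁ λ _ → z≤n
    least-redex-level (suc l) t with least-redex-level l t
    ... | inj₂ (m , m<l , r , nb) = inj₂ (m , m<n⇒m<1+n m<l , r , nb)
    ... | inj₁ nb with redexAt? l t
    ...   | yes r  = inj₂ (l , n<1+n l , r , nb)
    ...   | no ¬r = inj₁ λ r′ → ≤∧≢⇒< (nb r′) λ { refl → ¬r r′ }

    classify : Step l t u → t ⟶ℓℓ u ⊎ t ⇒¬ℓℓ u
    classify {l} {t} st with least-redex-level l t
    ... | inj₁ nb                = inj₁ (l , st , nb)
    ... | inj₂ (m , m<l , r , nb) = inj₂ (m , r , nb , par-antitone m<l (step⇒par st))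

    internal-steps : RedexAt m t → NoRedexBelow m t → Star (StepFrom (suc m)) t u
                   → Star _⟶¬ℓℓ_ t u × RedexAt m u × NoRedexBelow m u
    internal-steps r nb ε = ε , r , nb
    internal-steps {m} r nb ((l , m<l , st) ◅ sts) with
      internal-steps (step-keeps-redexAt st m<l r) (step-keeps-noRedexBelow st (<⇒≤ m<l) nb) sts
    ... | ints , r′ , nb′ = (l , m , st , r , m<l) ◅ ints , r′ , nb′

    ⇒¬ℓℓ-steps : ReflClosure _⇒¬ℓℓ_ t u → Star _⟶¬ℓℓ_ t u
    ⇒¬ℓℓ-steps refl⁼                 = ε
    ⇒¬ℓℓ-steps [ m , r , nb , par ] with internal-steps r nb (par⇒steps par)
    ... | ints , _ = ints

    least-level-steps : NoRedexBelow k t → Star (Step k) t u → Star _⟶ℓℓ_ t u × NoRedexBelow k u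
    least-level-steps nb ε = ε , nb
    least-level-steps {k} nb (st ◅ sts) with least-level-steps (step-keeps-noRedexBelow st ≤-refl nb) sts
    ... | lls , nb′ = (k , st , nb) ◅ lls , nb′

    -- Split off the level-k steps and recurse one level higher; above depth u nothing is left.
    par-factorizes : ∀ n k → Par k t u → NoRedexBelow k t → depth u < k + n
                   → ∃[ s ] (Star _⟶ℓℓ_ t s × ReflClosure _⇒¬ℓℓ_ s u)
    par-factorizes {t} zero k par nb lt =
      t , ε , ≡.subst (ReflClosure _⇒¬ℓℓ_ t) (par-trivial par (≡.subst (_ <_) (+-identityʳ k) lt)) refl⁼
    par-factorizes {u = u} (suc n) k par nb lt with par-split par
    ... | s , sts , par′ with least-level-steps nb sts
    ...   | lls , nbs with redexAt? k s
    ...     | yes r = s , lls , [ k , r , nbs , par′ ]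
    ...     | no ¬r with par-factorizes n (suc k) par′ (λ r′ → ≤∧≢⇒< (nbs r′) λ { refl → ¬r r′ })
                                          (≡.subst (depth u <_) (+-suc k n) lt)
    ...       | s′ , lls′ , ip = s′ , lls ◅◅ lls′ , ip

    -- u has the same least level m as t, so the level-m step merges into the Par (suc m) step.
    postpone : ReflClosure _⇒¬ℓℓ_ t u → u ⟶ℓℓ w → ∃[ s ] (Star _⟶ℓℓ_ t s × ReflClosure _⇒¬ℓℓ_ s w)
    postpone {w = w} refl⁼ ll = w , ll ◅ ε , refl⁼
    postpone {w = w} [ m , r , nb , par ] (l , st , nbu) with internal-steps r nb (par⇒steps par)
    ... | _ , ru , nbmu with ≤-antisym (nbu ru) (nbmu (_ , st))
    ... | refl = par-factorizes (suc (depth w)) m (par-merge par st) nb (≤-trans (n<1+n (depth w)) (m≤n+m _ m))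

    postpone* : ReflClosure _⇒¬ℓℓ_ t u → Star _⟶ℓℓ_ u w → ∃[ s ] (Star _⟶ℓℓ_ t s × ReflClosure _⇒¬ℓℓ_ s w)
    postpone* {t} ip ε = t , ε , ip
    postpone* ip (ll ◅ lls) with postpone ip ll
    ... | s , lls₁ , ip₁ with postpone* ip₁ lls
    ...   | s′ , lls₂ , ip₂ = s′ , lls₁ ◅◅ lls₂ , ip₂

    factorizes : Factorizes
    factorizes {t} ε = t , ε , ε
    factorizes ((l , st) ◅ sts) with factorizes sts
    ... | s , lls , ints with classify st
    ...   | inj₁ ll = s , ll ◅ lls , ints
    ...   | inj₂ ip with postpone* [ ip ] lls
    ...     | s′ , lls′ , ip′ = s′ , lls′ , ⇒¬ℓℓ-steps ip′ ◅◅ ints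

  module _ {C : Set} {plug : C → Term → Term} {level : C → ℕ} {root : Term → Term → Set} where
    open Calculus plug level root using (StepVia; stepVia; ctx; Decomp; decomp; LLStep; IntStep; LeastLevelFactorization)

    record Presentation : Set where
      field
        via⇒step : ∀ {t u} (s : StepVia t u) → Step (level (ctx s)) t u
        step⇒via : ∀ {l t u} → Step l t u → Σ (StepVia t u) λ s → level (ctx s) ≡ l

    least-level-factorization : Presentation → Factorizes → LeastLevelFactorization
    least-level-factorization pres fact sts =
      let s , lls , ints = fact (gmap id (λ s → _ , via⇒step s) sts)
      in  s , gmap id ll lls , gmap id int ints
      where
      open Presentation pres
      redex : (d : Decomp t) → RedexAt (level (Decomp.ctx d)) t
      redex (decomp c r r′ isRoot refl) = _ , via⇒step (stepVia c r r′ isRoot refl refl)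
      ll : t ⟶ℓℓ u → LLStep t u
      ll (l , st , nb) with step⇒via st
      ... | s , refl = s , λ d → nb (redex d)
      int : t ⟶¬ℓℓ u → IntStep t u
      int (l , m , st , (_ , st′) , m<l) with step⇒via st | step⇒via st′
      ... | s , refl | stepVia c r r′ isRoot eq _ , refl = s , decomp c r r′ isRoot eq , m<l

module Transfer {A B : Set} {StepA : ℕ → A → A → Set} {StepB : ℕ → B → B → Set}
  (f : A → B) (f-injective : ∀ {t u} → f t ≡ f u → t ≡ u)
  (f-step : ∀ {l t u} → StepA l t u → StepB l (f t) (f u))
  (f-step⁻¹ : ∀ {l t u} → StepB l (f t) u → ∃[ u′ ] (u ≡ f u′ × StepA l t u′))
  where

  private
    module A = LeastLevel StepA
    module B = LeastLevel StepB

  star-reflect : {RA : A → A → Set} {RB : B → B → Set}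
               → (∀ {t u} → RB (f t) u → ∃[ u′ ] (u ≡ f u′ × RA t u′))
               → ∀ {t u} → Star RB (f t) u → ∃[ u′ ] (u ≡ f u′ × Star RA t u′)
  star-reflect reflect {t} ε = t , refl , ε
  star-reflect reflect (x ◅ xs) with reflect x
  ... | _ , refl , y with star-reflect reflect xs
  ...   | u , eq , ys = u , eq , y ◅ ys

  ll-reflect : ∀ {t u} → f t B.⟶ℓℓ u → ∃[ u′ ] (u ≡ f u′ × t A.⟶ℓℓ u′)
  ll-reflect (l , st , nb) with f-step⁻¹ st
  ... | u′ , eq , st′ = u′ , eq , l , st′ , λ (_ , st″) → nb (_ , f-step st″)

  int-reflect : ∀ {t u} → f t B.⟶¬ℓℓ u → ∃[ u′ ] (u ≡ f u′ × t A.⟶¬ℓℓ u′)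
  int-reflect (l , m , st , (_ , st″) , m<l) with f-step⁻¹ st | f-step⁻¹ st″
  ... | u′ , eq , st′ | _ , _ , st‴ = u′ , eq , l , m , st′ , (_ , st‴) , m<l

  factorizes : B.Factorizes → A.Factorizes
  factorizes fact sts with fact (gmap f (λ (l , st) → l , f-step st) sts)
  ... | _ , lls , ints with star-reflect ll-reflect lls
  ...   | s , refl , lls′ with star-reflect int-reflect ints
  ...     | u , eq , ints′ with f-injective eq
  ...       | refl = s , lls′ , ints′

module BangSubstitution where

  ext : (ℕ → ℕ) → ℕ → ℕ
  ext ρ zero    = zero
  ext ρ (suc x) = suc (ρ x)

  rename : (ℕ → ℕ) → BTerm → BTerm
  rename ρ (var x)     = var (ρ x)
  rename ρ (lam t)     = lam (rename (ext ρ) t)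
  rename ρ (app t s)   = app (rename ρ t) (rename ρ s)
  rename ρ (bang t)    = bang (rename ρ t)
  rename ρ (oplus t s) = oplus (rename ρ t) (rename ρ s)

  exts : (ℕ → BTerm) → ℕ → BTerm
  exts σ zero    = var zero
  exts σ (suc x) = rename suc (σ x)

  sub : (ℕ → BTerm) → BTerm → BTerm
  sub σ (var x)     = σ x
  sub σ (lam t)     = lam (sub (exts σ) t)
  sub σ (app t s)   = app (sub σ t) (sub σ s)
  sub σ (bang t)    = bang (sub σ t)
  sub σ (oplus t s) = oplus (sub σ t) (sub σ s)

  ext-cong : ∀ {ρ ρ′} → ρ ≗ ρ′ → ext ρ ≗ ext ρ′
  ext-cong eq zero    = refl
  ext-cong eq (suc x) = cong suc (eq x)

  rename-cong : ∀ {ρ ρ′} → ρ ≗ ρ′ → rename ρ ≗ rename ρ′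
  rename-cong eq (var x)     = cong var (eq x)
  rename-cong eq (lam t)     = cong lam (rename-cong (ext-cong eq) t)
  rename-cong eq (app t s)   = cong₂ app (rename-cong eq t) (rename-cong eq s)
  rename-cong eq (bang t)    = cong bang (rename-cong eq t)
  rename-cong eq (oplus t s) = cong₂ oplus (rename-cong eq t) (rename-cong eq s)

  exts-cong : ∀ {σ σ′} → σ ≗ σ′ → exts σ ≗ exts σ′
  exts-cong eq zero    = refl
  exts-cong eq (suc x) = cong (rename suc) (eq x)

  sub-cong : ∀ {σ σ′} → σ ≗ σ′ → sub σ ≗ sub σ′
  sub-cong eq (var x)     = eq x
  sub-cong eq (lam t)     = cong lam (sub-cong (exts-cong eq) t)
  sub-cong eq (app t s)   = cong₂ app (sub-cong eq t) (sub-cong eq s)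
  sub-cong eq (bang t)    = cong bang (sub-cong eq t)
  sub-cong eq (oplus t s) = cong₂ oplus (sub-cong eq t) (sub-cong eq s)

  rename-rename : ∀ ρ ρ′ t → rename ρ (rename ρ′ t) ≡ rename (ρ ∘ ρ′) t
  rename-rename ρ ρ′ (var x)     = refl
  rename-rename ρ ρ′ (lam t)     =
    cong lam (trans (rename-rename (ext ρ) (ext ρ′) t) (rename-cong (λ { zero → refl ; (suc x) → refl }) t))
  rename-rename ρ ρ′ (app t s)   = cong₂ app (rename-rename ρ ρ′ t) (rename-rename ρ ρ′ s)
  rename-rename ρ ρ′ (bang t)    = cong bang (rename-rename ρ ρ′ t)
  rename-rename ρ ρ′ (oplus t s) = cong₂ oplus (rename-rename ρ ρ′ t) (rename-rename ρ ρ′ s)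

  sub-rename : ∀ σ ρ t → sub σ (rename ρ t) ≡ sub (σ ∘ ρ) t
  sub-rename σ ρ (var x)     = refl
  sub-rename σ ρ (lam t)     =
    cong lam (trans (sub-rename (exts σ) (ext ρ) t) (sub-cong (λ { zero → refl ; (suc x) → refl }) t))
  sub-rename σ ρ (app t s)   = cong₂ app (sub-rename σ ρ t) (sub-rename σ ρ s)
  sub-rename σ ρ (bang t)    = cong bang (sub-rename σ ρ t)
  sub-rename σ ρ (oplus t s) = cong₂ oplus (sub-rename σ ρ t) (sub-rename σ ρ s)

  rename-sub : ∀ ρ σ t → rename ρ (sub σ t) ≡ sub (rename ρ ∘ σ) t
  rename-sub ρ σ (var x)     = refl
  rename-sub ρ σ (lam t)     = cong lam (trans (rename-sub (ext ρ) (exts σ) t) (sub-cong ext-exts t))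
    where
    ext-exts : rename (ext ρ) ∘ exts σ ≗ exts (rename ρ ∘ σ)
    ext-exts zero    = refl
    ext-exts (suc x) = trans (rename-rename (ext ρ) suc (σ x)) (sym (rename-rename suc ρ (σ x)))
  rename-sub ρ σ (app t s)   = cong₂ app (rename-sub ρ σ t) (rename-sub ρ σ s)
  rename-sub ρ σ (bang t)    = cong bang (rename-sub ρ σ t)
  rename-sub ρ σ (oplus t s) = cong₂ oplus (rename-sub ρ σ t) (rename-sub ρ σ s)

  sub-sub : ∀ τ σ t → sub τ (sub σ t) ≡ sub (sub τ ∘ σ) t
  sub-sub τ σ (var x)     = refl
  sub-sub τ σ (lam t)     = cong lam (trans (sub-sub (exts τ) (exts σ) t) (sub-cong exts-exts t))
    where
    exts-exts : sub (exts τ) ∘ exts σ ≗ exts (sub τ ∘ σ)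
    exts-exts zero    = refl
    exts-exts (suc x) = trans (sub-rename (exts τ) suc (σ x)) (sym (rename-sub suc τ (σ x)))
  sub-sub τ σ (app t s)   = cong₂ app (sub-sub τ σ t) (sub-sub τ σ s)
  sub-sub τ σ (bang t)    = cong bang (sub-sub τ σ t)
  sub-sub τ σ (oplus t s) = cong₂ oplus (sub-sub τ σ t) (sub-sub τ σ s)

  sub-var : ∀ t → sub var t ≡ t
  sub-var (var x)     = refl
  sub-var (lam t)     = cong lam (trans (sub-cong (λ { zero → refl ; (suc x) → refl }) t) (sub-var t))
  sub-var (app t s)   = cong₂ app (sub-var t) (sub-var s)
  sub-var (bang t)    = cong bang (sub-var t)
  sub-var (oplus t s) = cong₂ oplus (sub-var t) (sub-var s)

  shift-var : ℕ → ℕ → ℕ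
  shift-var c x = if x <ᵇ c then x else suc x

  bshift≡rename : ∀ c t → bshift c t ≡ rename (shift-var c) t
  bshift≡rename c (var x) with x <ᵇ c
  ... | true  = refl
  ... | false = refl
  bshift≡rename c (lam t) = cong lam (trans (bshift≡rename (suc c) t) (rename-cong shift-var-suc t))
    where
    shift-var-suc : shift-var (suc c) ≗ ext (shift-var c)
    shift-var-suc zero = refl
    shift-var-suc (suc x) with x <ᵇ c
    ... | true  = refl
    ... | false = refl
  bshift≡rename c (app t s)   = cong₂ app (bshift≡rename c t) (bshift≡rename c s)
  bshift≡rename c (bang t)    = cong bang (bshift≡rename c t)
  bshift≡rename c (oplus t s) = cong₂ oplus (bshift≡rename c t) (bshift≡rename c s)

  bshift0≡rename-suc : ∀ t → bshift 0 t ≡ rename suc t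
  bshift0≡rename-suc = bshift≡rename 0

  subst-var : ℕ → BTerm → ℕ → BTerm
  subst-var k s x = if x <ᵇ k then var x else (if x ≡ᵇ k then s else var (pred x))

  subst-var-suc : ∀ k s → subst-var (suc k) (bshift 0 s) ≗ exts (subst-var k s)
  subst-var-suc k       s zero          = refl
  subst-var-suc zero    s (suc zero)    = bshift0≡rename-suc s
  subst-var-suc zero    s (suc (suc x)) = refl
  subst-var-suc (suc k) s (suc zero)    = refl
  subst-var-suc (suc k) s (suc (suc x)) with x <ᵇ k
  ... | true = refl
  ... | false with x ≡ᵇ k
  ...   | true  = bshift0≡rename-suc s
  ...   | false = refl

  bsubst≡sub : ∀ k s t → bsubst k s t ≡ sub (subst-var k s) t
  bsubst≡sub k s (var x)     = refl
  bsubst≡sub k s (lam t)     = cong lam (trans (bsubst≡sub (suc k) (bshift 0 s) t) (sub-cong (subst-var-suc k s) t))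
  bsubst≡sub k s (app t u)   = cong₂ app (bsubst≡sub k s t) (bsubst≡sub k s u)
  bsubst≡sub k s (bang t)    = cong bang (bsubst≡sub k s t)
  bsubst≡sub k s (oplus t u) = cong₂ oplus (bsubst≡sub k s t) (bsubst≡sub k s u)

  bshift-B[] : ∀ c s t → bshift c (t B[ s ]) ≡ bshift (suc c) t B[ bshift c s ]
  bshift-B[] c s t = begin
    bshift c (t B[ s ])                                  ≡⟨ bshift≡rename c _ ⟩
    rename (shift-var c) (bsubst 0 s t)                  ≡⟨ cong (rename (shift-var c)) (bsubst≡sub 0 s t) ⟩
    rename (shift-var c) (sub (subst-var 0 s) t)         ≡⟨ rename-sub (shift-var c) (subst-var 0 s) t ⟩
    sub (rename (shift-var c) ∘ subst-var 0 s) t         ≡⟨ sub-cong commute t ⟩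
    sub (subst-var 0 (bshift c s) ∘ shift-var (suc c)) t ≡⟨ sym (sub-rename (subst-var 0 (bshift c s)) (shift-var (suc c)) t) ⟩
    sub (subst-var 0 (bshift c s)) (rename (shift-var (suc c)) t)
      ≡⟨ cong (sub (subst-var 0 (bshift c s))) (sym (bshift≡rename (suc c) t)) ⟩
    sub (subst-var 0 (bshift c s)) (bshift (suc c) t)    ≡⟨ sym (bsubst≡sub 0 (bshift c s) (bshift (suc c) t)) ⟩
    bshift (suc c) t B[ bshift c s ]                     ∎
    where
    open ≡-Reasoning
    commute : rename (shift-var c) ∘ subst-var 0 s ≗ subst-var 0 (bshift c s) ∘ shift-var (suc c)
    commute zero = sym (bshift≡rename c s)
    commute (suc y) with y <ᵇ c
    ... | true  = refl
    ... | false = refl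

  sub-subst-var-bshift0 : ∀ s t → sub (subst-var 0 s) (bshift 0 t) ≡ t
  sub-subst-var-bshift0 s t =
    trans (cong (sub (subst-var 0 s)) (bshift0≡rename-suc t)) (trans (sub-rename _ suc t) (sub-var t))

  subst-var-commute : ∀ j r s y → sub (subst-var j r) (subst-var 0 s (suc y))
                                ≡ sub (subst-var 0 (bsubst j r s)) (subst-var (suc j) (bshift 0 r) (suc y))
  subst-var-commute zero    r s zero    = sym (sub-subst-var-bshift0 _ r)
  subst-var-commute (suc j) r s zero    = refl
  subst-var-commute zero    r s (suc y) = refl
  subst-var-commute (suc j) r s (suc y) with y <ᵇ j
  ... | true = refl
  ... | false with y ≡ᵇ j
  ...   | true  = sym (sub-subst-var-bshift0 _ r)
  ...   | false = refl

  bsubst-B[] : ∀ j r s t → bsubst j r (t B[ s ]) ≡ bsubst (suc j) (bshift 0 r) t B[ bsubst j r s ]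
  bsubst-B[] j r s t = begin
    bsubst j r (t B[ s ])                                         ≡⟨ bsubst≡sub j r (t B[ s ]) ⟩
    sub (subst-var j r) (bsubst 0 s t)                            ≡⟨ cong (sub (subst-var j r)) (bsubst≡sub 0 s t) ⟩
    sub (subst-var j r) (sub (subst-var 0 s) t)                   ≡⟨ sub-sub (subst-var j r) (subst-var 0 s) t ⟩
    sub (sub (subst-var j r) ∘ subst-var 0 s) t                   ≡⟨ sub-cong commute t ⟩
    sub (sub (subst-var 0 s′) ∘ subst-var (suc j) (bshift 0 r)) t ≡⟨ sym (sub-sub (subst-var 0 s′) (subst-var (suc j) (bshift 0 r)) t) ⟩
    sub (subst-var 0 s′) (sub (subst-var (suc j) (bshift 0 r)) t)
      ≡⟨ cong (sub (subst-var 0 s′)) (sym (bsubst≡sub (suc j) (bshift 0 r) t)) ⟩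
    sub (subst-var 0 s′) (bsubst (suc j) (bshift 0 r) t)          ≡⟨ sym (bsubst≡sub 0 s′ (bsubst (suc j) (bshift 0 r) t)) ⟩
    bsubst (suc j) (bshift 0 r) t B[ s′ ]                         ∎
    where
    open ≡-Reasoning
    s′ = bsubst j r s
    commute : sub (subst-var j r) ∘ subst-var 0 s ≗ sub (subst-var 0 s′) ∘ subst-var (suc j) (bshift 0 r)
    commute zero    = sym (bsubst≡sub j r s)
    commute (suc y) = subst-var-commute j r s y

module BangCalculus where

  open BangSubstitution using (bshift-B[]; bsubst-B[])

  private variable
    j k l m : ℕ
    r r′ r₁ s s′ t t′ u w : BTerm

  data Step : ℕ → BTerm → BTerm → Set where
    root   : BRoot t u → Step 0 t u
    lam    : Step l t u → Step l (lam t) (lam u)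
    appˡ   : ∀ s → Step l t u → Step l (app t s) (app u s)
    appʳ   : ∀ s → Step l t u → Step l (app s t) (app s u)
    bang   : Step l t u → Step (suc l) (bang t) (bang u)
    oplusˡ : ∀ s → Step l t u → Step (suc l) (oplus t s) (oplus u s)
    oplusʳ : ∀ s → Step l t u → Step (suc l) (oplus s t) (oplus s u)

  open LeastLevel Step

  -- Par k contracts in parallel redexes at level ≥ k only: the index drops by one under ! and ⊕,
  -- and pred 0 = 0 makes Par 0 the full parallel reduction.
  data Par : ℕ → BTerm → BTerm → Set where
    var   : ∀ x → Par k (var x) (var x)
    lam   : Par k t t′ → Par k (lam t) (lam t′)
    app   : Par k t t′ → Par k s s′ → Par k (app t s) (app t′ s′)
    bang  : Par (pred k) t t′ → Par k (bang t) (bang t′)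
    oplus : Par (pred k) t t′ → Par (pred k) s s′ → Par k (oplus t s) (oplus t′ s′)
    β!    : Par 0 t t′ → Par 0 s s′ → Par 0 (app (lam t) (bang s)) (t′ B[ s′ ])
    ⊕₁    : ∀ s → Par 0 t t′ → Par 0 (oplus t s) t′
    ⊕₂    : ∀ t → Par 0 s s′ → Par 0 (oplus t s) s′

  par-refl : ∀ k t → Par k t t
  par-refl k (var x)     = var x
  par-refl k (lam t)     = lam (par-refl k t)
  par-refl k (app t s)   = app (par-refl k t) (par-refl k s)
  par-refl k (bang t)    = bang (par-refl (pred k) t)
  par-refl k (oplus t s) = oplus (par-refl (pred k) t) (par-refl (pred k) s)

  par-suc : Par (suc k) t u → Par k t u
  par-pred : Par k t u → Par (pred k) t u
  par-pred {zero}  par = par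
  par-pred {suc k} par = par-suc par
  par-suc (var x)       = var x
  par-suc (lam p)       = lam (par-suc p)
  par-suc (app p q)     = app (par-suc p) (par-suc q)
  par-suc (bang p)      = bang (par-pred p)
  par-suc (oplus p q)   = oplus (par-pred p) (par-pred q)

  par-antitone : j ≤ k → Par k t u → Par j t u
  par-antitone j≤k = go (≤⇒≤′ j≤k)
    where
    go : j ≤′ k → Par k t u → Par j t u
    go ≤′-refl        par = par
    go (≤′-step j≤′k) par = go j≤′k (par-suc par)

  step⇒par : Step l t u → Par l t u
  step⇒par (root (!β t s))  = β! (par-refl 0 t) (par-refl 0 s)
  step⇒par (root (⊕₁ p q))  = ⊕₁ q (par-refl 0 p)
  step⇒par (root (⊕₂ p q))  = ⊕₂ p (par-refl 0 q)
  step⇒par (lam st)         = lam (step⇒par st)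
  step⇒par {l} (appˡ s st)  = app (step⇒par st) (par-refl l s)
  step⇒par {l} (appʳ s st)  = app (par-refl l s) (step⇒par st)
  step⇒par (bang st)        = bang (step⇒par st)
  step⇒par {suc l} (oplusˡ s st) = oplus (step⇒par st) (par-refl l s)
  step⇒par {suc l} (oplusʳ s st) = oplus (par-refl l s) (step⇒par st)

  bshift-step : ∀ c → Step l t u → Step l (bshift c t) (bshift c u)
  bshift-step c (root (!β t s)) = ≡.subst (Step 0 _) (sym (bshift-B[] c s t)) (root (!β _ _))
  bshift-step c (root (⊕₁ p q)) = root (⊕₁ _ _)
  bshift-step c (root (⊕₂ p q)) = root (⊕₂ _ _)
  bshift-step c (lam st)        = lam (bshift-step (suc c) st)
  bshift-step c (appˡ s st)     = appˡ _ (bshift-step c st)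
  bshift-step c (appʳ s st)     = appʳ _ (bshift-step c st)
  bshift-step c (bang st)       = bang (bshift-step c st)
  bshift-step c (oplusˡ s st)   = oplusˡ _ (bshift-step c st)
  bshift-step c (oplusʳ s st)   = oplusʳ _ (bshift-step c st)

  bshift-par : ∀ c → Par k t u → Par k (bshift c t) (bshift c u)
  bshift-par {k} c (var x) = par-refl k _
  bshift-par c (lam p)     = lam (bshift-par (suc c) p)
  bshift-par c (app p q)   = app (bshift-par c p) (bshift-par c q)
  bshift-par c (bang p)    = bang (bshift-par c p)
  bshift-par c (oplus p q) = oplus (bshift-par c p) (bshift-par c q)
  bshift-par c (β! {t′ = t′} {s′ = s′} p q) =
    ≡.subst (Par 0 _) (sym (bshift-B[] c s′ t′)) (β! (bshift-par (suc c) p) (bshift-par c q))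
  bshift-par c (⊕₁ s p)    = ⊕₁ _ (bshift-par c p)
  bshift-par c (⊕₂ t p)    = ⊕₂ _ (bshift-par c p)

  bsubst-par : ∀ j → Par 0 t t′ → Par 0 r r′ → Par 0 (bsubst j r t) (bsubst j r′ t′)
  bsubst-par j (var x) pr with x <ᵇ j
  ... | true = var x
  ... | false with x ≡ᵇ j
  ...   | true  = pr
  ...   | false = var _
  bsubst-par j (lam p) pr     = lam (bsubst-par (suc j) p (bshift-par 0 pr))
  bsubst-par j (app p q) pr   = app (bsubst-par j p pr) (bsubst-par j q pr)
  bsubst-par j (bang p) pr    = bang (bsubst-par j p pr)
  bsubst-par j (oplus p q) pr = oplus (bsubst-par j p pr) (bsubst-par j q pr)
  bsubst-par {r′ = r′} j (β! {t′ = t′} {s′ = s′} p q) pr =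
    ≡.subst (Par 0 _) (sym (bsubst-B[] j r′ s′ t′)) (β! (bsubst-par (suc j) p (bshift-par 0 pr)) (bsubst-par j q pr))
  bsubst-par j (⊕₁ s p) pr    = ⊕₁ _ (bsubst-par j p pr)
  bsubst-par j (⊕₂ t p) pr    = ⊕₂ _ (bsubst-par j p pr)

  Split : ℕ → BTerm → BTerm → Set
  Split k t u = ∃[ s ] (Star (Step k) t s × Par (suc k) s u)

  split-app : Split k t t′ → Split k s s′ → Split k (app t s) (app t′ s′)
  split-app (t₁ , sts , p) (s₁ , sts′ , q) = app t₁ s₁ , gmap _ (appˡ _) sts ◅◅ gmap _ (appʳ _) sts′ , app p q

  -- The argument's level-0 steps are replayed at each occurrence of the variable at level 0;
  -- occurrences under ! or ⊕ are at level ≥ 1, where the whole Par 0 step of the argument is allowed.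
  bsubst-split : ∀ j → Par 1 t t′ → Star (Step 0) r r₁ → Par 1 r₁ r′ → Par 0 r r′
               → Split 0 (bsubst j r t) (bsubst j r′ t′)
  bsubst-split j (var x) sts p₁ p₀ with x <ᵇ j
  ... | true = var x , ε , var x
  ... | false with x ≡ᵇ j
  ...   | true  = _ , sts , p₁
  ...   | false = _ , ε , var _
  bsubst-split j (lam p) sts p₁ p₀ with bsubst-split (suc j) p (gmap _ (bshift-step 0) sts) (bshift-par 0 p₁) (bshift-par 0 p₀)
  ... | s , sts′ , q = lam s , gmap _ lam sts′ , lam q
  bsubst-split j (app p q) sts p₁ p₀ = split-app (bsubst-split j p sts p₁ p₀) (bsubst-split j q sts p₁ p₀)
  bsubst-split j (bang p) sts p₁ p₀    = _ , ε , bang (bsubst-par j p p₀)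
  bsubst-split j (oplus p q) sts p₁ p₀ = _ , ε , oplus (bsubst-par j p p₀) (bsubst-par j q p₀)

  par-split : Par k t u → Split k t u
  par-split (var x)   = var x , ε , var x
  par-split (lam p) with par-split p
  ... | s , sts , q = lam s , gmap _ lam sts , lam q
  par-split (app p q) = split-app (par-split p) (par-split q)
  par-split {zero} (bang {t = t} p) = bang t , ε , bang p
  par-split {suc k} (bang p) with par-split p
  ... | s , sts , q = bang s , gmap _ bang sts , bang q
  par-split {zero} (oplus {t = t} {s = s} p q) = oplus t s , ε , oplus p q
  par-split {suc k} (oplus p q) with par-split p | par-split q
  ... | t₁ , sts , p′ | s₁ , sts′ , q′ =
    oplus t₁ s₁ , gmap _ (oplusˡ _) sts ◅◅ gmap _ (oplusʳ _) sts′ , oplus p′ q′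
  par-split (β! {t = t} {s = s} p q) with par-split p | par-split q
  ... | t₁ , sts , p′ | s₁ , sts′ , q′ with bsubst-split 0 p′ sts′ q′ q
  ...   | r , sts″ , r′ = r , gmap _ (λ st → appˡ _ (lam st)) sts ◅◅ root (!β t₁ s) ◅ sts″ , r′
  par-split (⊕₁ s p) with par-split p
  ... | r , sts , q = r , root (⊕₁ _ s) ◅ sts , q
  par-split (⊕₂ t p) with par-split p
  ... | r , sts , q = r , root (⊕₂ t _) ◅ sts , q

  depth : BTerm → ℕ
  depth (var x)     = 0
  depth (lam t)     = depth t
  depth (app t s)   = depth t ⊔ depth s
  depth (bang t)    = suc (depth t)
  depth (oplus t s) = suc (depth t ⊔ depth s)

  par-trivial : Par k t u → depth u < k → t ≡ u
  par-trivial (var x) _ = refl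
  par-trivial (lam p) lt = cong lam (par-trivial p lt)
  par-trivial (app {t′ = t′} {s′ = s′} p q) lt =
    cong₂ app (par-trivial p (m⊔n<o⇒m<o (depth t′) _ lt)) (par-trivial q (m⊔n<o⇒n<o _ (depth s′) lt))
  par-trivial {suc k} (bang p) lt = cong bang (par-trivial p (≤-pred lt))
  par-trivial {suc k} (oplus {t′ = t′} {s′ = s′} p q) lt =
    cong₂ oplus (par-trivial p (m⊔n<o⇒m<o (depth t′) _ (≤-pred lt))) (par-trivial q (m⊔n<o⇒n<o _ (depth s′) (≤-pred lt)))

  step-keeps-redexAt : Step l t u → m < l → RedexAt m t → RedexAt m u
  step-keeps-redexAt (appˡ _ (lam _))  _ (_ , root (!β _ b)) = _ , root (!β _ b)
  step-keeps-redexAt (appʳ _ (bang _)) _ (_ , root (!β a _)) = _ , root (!β a _)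
  step-keeps-redexAt (oplusˡ _ _) _ (_ , root (⊕₁ _ _)) = _ , root (⊕₁ _ _)
  step-keeps-redexAt (oplusˡ _ _) _ (_ , root (⊕₂ _ _)) = _ , root (⊕₁ _ _)
  step-keeps-redexAt (oplusʳ _ _) _ (_ , root (⊕₁ _ _)) = _ , root (⊕₁ _ _)
  step-keeps-redexAt (oplusʳ _ _) _ (_ , root (⊕₂ _ _)) = _ , root (⊕₁ _ _)
  step-keeps-redexAt (lam st) lt (_ , lam st′) = map lam lam (step-keeps-redexAt st lt (_ , st′))
  step-keeps-redexAt (appˡ _ st) lt (_ , appˡ _ st′) = map _ (appˡ _) (step-keeps-redexAt st lt (_ , st′))
  step-keeps-redexAt (appʳ _ _)  _  (_ , appˡ _ st′) = _ , appˡ _ st′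
  step-keeps-redexAt (appˡ _ _)  _  (_ , appʳ _ st′) = _ , appʳ _ st′
  step-keeps-redexAt (appʳ _ st) lt (_ , appʳ _ st′) = map _ (appʳ _) (step-keeps-redexAt st lt (_ , st′))
  step-keeps-redexAt (bang st) lt (_ , bang st′) = map bang bang (step-keeps-redexAt st (≤-pred lt) (_ , st′))
  step-keeps-redexAt (oplusˡ _ st) lt (_ , oplusˡ _ st′) = map _ (oplusˡ _) (step-keeps-redexAt st (≤-pred lt) (_ , st′))
  step-keeps-redexAt (oplusʳ _ _)  _  (_ , oplusˡ _ st′) = _ , oplusˡ _ st′
  step-keeps-redexAt (oplusˡ _ _)  _  (_ , oplusʳ _ st′) = _ , oplusʳ _ st′
  step-keeps-redexAt (oplusʳ _ st) lt (_ , oplusʳ _ st′) = map _ (oplusʳ _) (step-keeps-redexAt st (≤-pred lt) (_ , st′))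

  step-keeps-noRedexBelow : Step l t u → m ≤ l → NoRedexBelow m t → NoRedexBelow m u
  step-keeps-noRedexBelow {m = zero} _ _ _ _ = z≤n
  step-keeps-noRedexBelow (lam st) le nb (_ , lam st′) = step-keeps-noRedexBelow st le (nb ∘ map lam lam) (_ , st′)
  step-keeps-noRedexBelow {l = suc _} (appˡ _ (lam _)) _ nb (_ , root (!β _ b)) = nb (_ , root (!β _ b))
  step-keeps-noRedexBelow (appˡ _ st) le nb (_ , appˡ _ st′) = step-keeps-noRedexBelow st le (nb ∘ map _ (appˡ _)) (_ , st′)
  step-keeps-noRedexBelow (appˡ _ _)  _  nb (_ , appʳ _ st′) = nb (_ , appʳ _ st′)
  step-keeps-noRedexBelow {l = suc _} (appʳ _ (bang _)) _ nb (_ , root (!β a _)) = nb (_ , root (!β a _))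
  step-keeps-noRedexBelow (appʳ _ _)  _  nb (_ , appˡ _ st′) = nb (_ , appˡ _ st′)
  step-keeps-noRedexBelow (appʳ _ st) le nb (_ , appʳ _ st′) = step-keeps-noRedexBelow st le (nb ∘ map _ (appʳ _)) (_ , st′)
  step-keeps-noRedexBelow {m = suc _} (bang st) (s≤s le) nb (_ , bang st′) =
    s≤s (step-keeps-noRedexBelow st le (s≤s⁻¹ ∘ nb ∘ map bang bang) (_ , st′))
  step-keeps-noRedexBelow (oplusˡ _ _) _ nb (_ , root (⊕₁ _ _)) = nb (_ , root (⊕₁ _ _))
  step-keeps-noRedexBelow (oplusˡ _ _) _ nb (_ , root (⊕₂ _ _)) = nb (_ , root (⊕₁ _ _))
  step-keeps-noRedexBelow (oplusʳ _ _) _ nb (_ , root (⊕₁ _ _)) = nb (_ , root (⊕₁ _ _))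
  step-keeps-noRedexBelow (oplusʳ _ _) _ nb (_ , root (⊕₂ _ _)) = nb (_ , root (⊕₁ _ _))
  step-keeps-noRedexBelow {m = suc _} (oplusˡ _ st) (s≤s le) nb (_ , oplusˡ _ st′) =
    s≤s (step-keeps-noRedexBelow st le (s≤s⁻¹ ∘ nb ∘ map _ (oplusˡ _)) (_ , st′))
  step-keeps-noRedexBelow (oplusˡ _ _) _ nb (_ , oplusʳ _ st′) = nb (_ , oplusʳ _ st′)
  step-keeps-noRedexBelow (oplusʳ _ _) _ nb (_ , oplusˡ _ st′) = nb (_ , oplusˡ _ st′)
  step-keeps-noRedexBelow {m = suc _} (oplusʳ _ st) (s≤s le) nb (_ , oplusʳ _ st′) =
    s≤s (step-keeps-noRedexBelow st le (s≤s⁻¹ ∘ nb ∘ map _ (oplusʳ _)) (_ , st′))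

  data LamBang : ℕ → BTerm → BTerm → Set where
    lam-bang : ∀ a b → LamBang 0 (lam a) (bang b)

  lamBang? : ∀ k t s → Dec (LamBang k t s)
  lamBang? zero (lam a) (bang b)    = yes (lam-bang a b)
  lamBang? zero (lam a) (var x)     = no λ ()
  lamBang? zero (lam a) (lam _)     = no λ ()
  lamBang? zero (lam a) (app _ _)   = no λ ()
  lamBang? zero (lam a) (oplus _ _) = no λ ()
  lamBang? zero (var x) s           = no λ ()
  lamBang? zero (app _ _) s         = no λ ()
  lamBang? zero (bang _) s          = no λ ()
  lamBang? zero (oplus _ _) s       = no λ ()
  lamBang? (suc k) t s              = no λ ()

  redexAt? : ∀ k t → Dec (RedexAt k t)
  redexAt? k (var x) = no λ { (_ , root ()) }
  redexAt? k (lam t) = map′ (map lam lam) (λ { (_ , lam st) → _ , st }) (redexAt? k t)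
  redexAt? k (app t s) with lamBang? k t s | redexAt? k t | redexAt? k s
  ... | yes (lam-bang a b) | _ | _ = yes (_ , root (!β a b))
  ... | no _ | yes r | _     = yes (map _ (appˡ s) r)
  ... | no _ | no _  | yes r = yes (map _ (appʳ t) r)
  ... | no ¬lb | no ¬r | no ¬r′ =
    no λ { (_ , root (!β a b)) → ¬lb (lam-bang a b) ; (_ , appˡ _ st) → ¬r (_ , st) ; (_ , appʳ _ st) → ¬r′ (_ , st) }
  redexAt? zero    (bang t) = no λ { (_ , root ()) }
  redexAt? (suc k) (bang t) = map′ (map bang bang) (λ { (_ , bang st) → _ , st }) (redexAt? k t)
  redexAt? zero    (oplus t s) = yes (_ , root (⊕₁ t s))
  redexAt? (suc k) (oplus t s) with redexAt? k t | redexAt? k s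
  ... | yes r | _     = yes (map _ (oplusˡ s) r)
  ... | no _  | yes r = yes (map _ (oplusʳ t) r)
  ... | no ¬r | no ¬r′ = no λ { (_ , oplusˡ _ st) → ¬r (_ , st) ; (_ , oplusʳ _ st) → ¬r′ (_ , st) }

  par⇒steps : Par k t u → Star (StepFrom k) t u
  par⇒steps (var x)     = ε
  par⇒steps (lam p)     = stepsFrom-map id id lam (par⇒steps p)
  par⇒steps (app p q)   = stepsFrom-map id id (appˡ _) (par⇒steps p) ◅◅ stepsFrom-map id id (appʳ _) (par⇒steps q)
  par⇒steps (bang p)    = stepsFrom-map suc pred≤⇒≤suc bang (par⇒steps p)
  par⇒steps (oplus p q) =
    stepsFrom-map suc pred≤⇒≤suc (oplusˡ _) (par⇒steps p) ◅◅ stepsFrom-map suc pred≤⇒≤suc (oplusʳ _) (par⇒steps q)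
  par⇒steps (β! {t′ = t′} {s′ = s′} p q) =
    stepsFrom-map id id (appˡ _ ∘ lam) (par⇒steps p) ◅◅ stepsFrom-map suc (λ _ → z≤n) (appʳ _ ∘ bang) (par⇒steps q)
    ◅◅ (0 , z≤n , root (!β t′ s′)) ◅ ε
  par⇒steps (⊕₁ s p)    = (0 , z≤n , root (⊕₁ _ s)) ◅ par⇒steps p
  par⇒steps (⊕₂ t p)    = (0 , z≤n , root (⊕₂ t _)) ◅ par⇒steps p

  par-merge : Par (suc k) t u → Step k u w → Par k t w
  par-merge (app (lam p) (bang q)) (root (!β _ _)) = β! (par-suc p) q
  par-merge (oplus p q) (root (⊕₁ _ _)) = ⊕₁ _ p
  par-merge (oplus p q) (root (⊕₂ _ _)) = ⊕₂ _ q
  par-merge (lam p)     (lam st)        = lam (par-merge p st)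
  par-merge (app p q)   (appˡ _ st)     = app (par-merge p st) (par-suc q)
  par-merge (app p q)   (appʳ _ st)     = app (par-suc p) (par-merge q st)
  par-merge (bang p)    (bang st)       = bang (par-merge p st)
  par-merge (oplus p q) (oplusˡ _ st)   = oplus (par-merge p st) (par-suc q)
  par-merge (oplus p q) (oplusʳ _ st)   = oplus (par-suc p) (par-merge q st)

  macroSteps : MacroSteps
  macroSteps = record
    { Par                     = Par
    ; depth                   = depth
    ; redexAt?                = redexAt?
    ; step-keeps-redexAt      = step-keeps-redexAt
    ; step-keeps-noRedexBelow = step-keeps-noRedexBelow
    ; step⇒par                = step⇒par
    ; par-antitone            = par-antitone
    ; par⇒steps               = par⇒steps
    ; par-trivial             = par-trivial
    ; par-split               = par-split
    ; par-merge               = par-merge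
    }

  open Bang using (StepVia; stepVia; ctx)

  plug-step : ∀ c {r r′} → BRoot r r′ → Step (blevel c) (bplug c r) (bplug c r′)
  plug-step hole         ρ = root ρ
  plug-step (lamC c)     ρ = lam (plug-step c ρ)
  plug-step (appR t c)   ρ = appʳ t (plug-step c ρ)
  plug-step (appL c t)   ρ = appˡ t (plug-step c ρ)
  plug-step (bangC c)    ρ = bang (plug-step c ρ)
  plug-step (oplusL c t) ρ = oplusˡ t (plug-step c ρ)
  plug-step (oplusR t c) ρ = oplusʳ t (plug-step c ρ)

  step⇒via : Step l t u → Σ (StepVia t u) λ s → blevel (ctx s) ≡ l
  step⇒via (root ρ) = stepVia hole _ _ ρ refl refl , refl
  step⇒via (lam st)      with step⇒via st
  ... | stepVia c _ _ ρ refl refl , refl = stepVia (lamC c) _ _ ρ refl refl , refl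
  step⇒via (appˡ s st)   with step⇒via st
  ... | stepVia c _ _ ρ refl refl , refl = stepVia (appL c s) _ _ ρ refl refl , refl
  step⇒via (appʳ s st)   with step⇒via st
  ... | stepVia c _ _ ρ refl refl , refl = stepVia (appR s c) _ _ ρ refl refl , refl
  step⇒via (bang st)     with step⇒via st
  ... | stepVia c _ _ ρ refl refl , refl = stepVia (bangC c) _ _ ρ refl refl , refl
  step⇒via (oplusˡ s st) with step⇒via st
  ... | stepVia c _ _ ρ refl refl , refl = stepVia (oplusL c s) _ _ ρ refl refl , refl
  step⇒via (oplusʳ s st) with step⇒via st
  ... | stepVia c _ _ ρ refl refl , refl = stepVia (oplusR s c) _ _ ρ refl refl , refl

  presentation : Presentation
  presentation = record
    { via⇒step = λ { (stepVia c _ _ ρ refl refl) → plug-step c ρ }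
    ; step⇒via = step⇒via
    }

  factorizes : Factorizes
  factorizes = Factorization.factorizes macroSteps

  bang-factorization : Bang.LeastLevelFactorization
  bang-factorization = least-level-factorization presentation factorizes

module CbNCalculus where

  private module B = BangCalculus
  open BangSubstitution using (bshift-B[]; bsubst-B[])

  private variable
    l : ℕ
    s t u : Term

  -- Girard's call-by-name translation: only arguments are boxed.
  ⌜_⌝ : Term → BTerm
  ⌜ var x ⌝     = var x
  ⌜ lam t ⌝     = lam ⌜ t ⌝
  ⌜ app t s ⌝   = app ⌜ t ⌝ (bang ⌜ s ⌝)
  ⌜ oplus t s ⌝ = oplus ⌜ t ⌝ ⌜ s ⌝

  erase : BTerm → Term
  erase (var x)     = var x
  erase (lam t)     = lam (erase t)
  erase (app t s)   = app (erase t) (erase s)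
  erase (bang t)    = erase t
  erase (oplus t s) = oplus (erase t) (erase s)

  erase-⌜⌝ : ∀ t → erase ⌜ t ⌝ ≡ t
  erase-⌜⌝ (var x)     = refl
  erase-⌜⌝ (lam t)     = cong lam (erase-⌜⌝ t)
  erase-⌜⌝ (app t s)   = cong₂ app (erase-⌜⌝ t) (erase-⌜⌝ s)
  erase-⌜⌝ (oplus t s) = cong₂ oplus (erase-⌜⌝ t) (erase-⌜⌝ s)

  ⌜⌝-injective : ⌜ t ⌝ ≡ ⌜ u ⌝ → t ≡ u
  ⌜⌝-injective {t} {u} eq = trans (sym (erase-⌜⌝ t)) (trans (cong erase eq) (erase-⌜⌝ u))

  ⌜⌝-shift : ∀ c t → ⌜ shift c t ⌝ ≡ bshift c ⌜ t ⌝
  ⌜⌝-shift c (var x) with x <ᵇ c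
  ... | true  = refl
  ... | false = refl
  ⌜⌝-shift c (lam t)     = cong lam (⌜⌝-shift (suc c) t)
  ⌜⌝-shift c (app t s)   = cong₂ app (⌜⌝-shift c t) (cong bang (⌜⌝-shift c s))
  ⌜⌝-shift c (oplus t s) = cong₂ oplus (⌜⌝-shift c t) (⌜⌝-shift c s)

  ⌜⌝-subst : ∀ k s t → ⌜ subst k s t ⌝ ≡ bsubst k ⌜ s ⌝ ⌜ t ⌝
  ⌜⌝-subst k s (var x) with x <ᵇ k
  ... | true = refl
  ... | false with x ≡ᵇ k
  ...   | true  = refl
  ...   | false = refl
  ⌜⌝-subst k s (lam t) =
    cong lam (trans (⌜⌝-subst (suc k) (shift 0 s) t) (cong (λ s′ → bsubst (suc k) s′ ⌜ t ⌝) (⌜⌝-shift 0 s)))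
  ⌜⌝-subst k s (app t u)   = cong₂ app (⌜⌝-subst k s t) (cong bang (⌜⌝-subst k s u))
  ⌜⌝-subst k s (oplus t u) = cong₂ oplus (⌜⌝-subst k s t) (⌜⌝-subst k s u)

  -- The substitution lemmas of Λ⊕ are those of the bang calculus, transported along ⌜_⌝.
  shift-[] : ∀ c s t → shift c (t [ s ]) ≡ shift (suc c) t [ shift c s ]
  shift-[] c s t = ⌜⌝-injective (begin
    ⌜ shift c (t [ s ]) ⌝                    ≡⟨ ⌜⌝-shift c (t [ s ]) ⟩
    bshift c ⌜ t [ s ] ⌝                     ≡⟨ cong (bshift c) (⌜⌝-subst 0 s t) ⟩
    bshift c (⌜ t ⌝ B[ ⌜ s ⌝ ])              ≡⟨ bshift-B[] c ⌜ s ⌝ ⌜ t ⌝ ⟩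
    bshift (suc c) ⌜ t ⌝ B[ bshift c ⌜ s ⌝ ] ≡⟨ sym (cong₂ _B[_] (⌜⌝-shift (suc c) t) (⌜⌝-shift c s)) ⟩
    ⌜ shift (suc c) t ⌝ B[ ⌜ shift c s ⌝ ]   ≡⟨ sym (⌜⌝-subst 0 (shift c s) (shift (suc c) t)) ⟩
    ⌜ shift (suc c) t [ shift c s ] ⌝        ∎)
    where open ≡-Reasoning

  subst-[] : ∀ j r s t → subst j r (t [ s ]) ≡ subst (suc j) (shift 0 r) t [ subst j r s ]
  subst-[] j r s t = ⌜⌝-injective (begin
    ⌜ subst j r (t [ s ]) ⌝                                    ≡⟨ ⌜⌝-subst j r (t [ s ]) ⟩
    bsubst j ⌜ r ⌝ ⌜ t [ s ] ⌝                                 ≡⟨ cong (bsubst j ⌜ r ⌝) (⌜⌝-subst 0 s t) ⟩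
    bsubst j ⌜ r ⌝ (⌜ t ⌝ B[ ⌜ s ⌝ ])                          ≡⟨ bsubst-B[] j ⌜ r ⌝ ⌜ s ⌝ ⌜ t ⌝ ⟩
    bsubst (suc j) (bshift 0 ⌜ r ⌝) ⌜ t ⌝ B[ bsubst j ⌜ r ⌝ ⌜ s ⌝ ]
      ≡⟨ sym (cong₂ _B[_] (trans (⌜⌝-subst (suc j) (shift 0 r) t) (cong (λ r′ → bsubst (suc j) r′ ⌜ t ⌝) (⌜⌝-shift 0 r)))
                          (⌜⌝-subst j r s)) ⟩
    ⌜ subst (suc j) (shift 0 r) t ⌝ B[ ⌜ subst j r s ⌝ ]       ≡⟨ sym (⌜⌝-subst 0 (subst j r s) (subst (suc j) (shift 0 r) t)) ⟩
    ⌜ subst (suc j) (shift 0 r) t [ subst j r s ] ⌝            ∎)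
    where open ≡-Reasoning

  data Step : ℕ → Term → Term → Set where
    root   : NRoot t u → Step 0 t u
    lam    : Step l t u → Step l (lam t) (lam u)
    appˡ   : ∀ s → Step l t u → Step l (app t s) (app u s)
    appʳ   : ∀ s → Step l t u → Step (suc l) (app s t) (app s u)
    oplusˡ : ∀ s → Step l t u → Step (suc l) (oplus t s) (oplus u s)
    oplusʳ : ∀ s → Step l t u → Step (suc l) (oplus s t) (oplus s u)

  ⌜⌝-step : Step l t u → B.Step l ⌜ t ⌝ ⌜ u ⌝
  ⌜⌝-step (root (β t s)) = ≡.subst (B.Step 0 _) (sym (⌜⌝-subst 0 s t)) (B.root (!β ⌜ t ⌝ ⌜ s ⌝))
  ⌜⌝-step (root (⊕₁ p q)) = B.root (⊕₁ _ _)
  ⌜⌝-step (root (⊕₂ p q)) = B.root (⊕₂ _ _)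
  ⌜⌝-step (lam st)        = B.lam (⌜⌝-step st)
  ⌜⌝-step (appˡ s st)     = B.appˡ _ (⌜⌝-step st)
  ⌜⌝-step (appʳ s st)     = B.appʳ _ (B.bang (⌜⌝-step st))
  ⌜⌝-step (oplusˡ s st)   = B.oplusˡ _ (⌜⌝-step st)
  ⌜⌝-step (oplusʳ s st)   = B.oplusʳ _ (⌜⌝-step st)

  ⌜⌝-step⁻¹ : ∀ {l t u} → B.Step l ⌜ t ⌝ u → ∃[ u′ ] (u ≡ ⌜ u′ ⌝ × Step l t u′)
  ⌜⌝-step⁻¹ {t = app (lam t) s} (B.root (!β _ _)) = t [ s ] , sym (⌜⌝-subst 0 s t) , root (β t s)
  ⌜⌝-step⁻¹ {t = var _} (B.root ())
  ⌜⌝-step⁻¹ {t = app (var _) _}     (B.root ())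
  ⌜⌝-step⁻¹ {t = app (app _ _) _}   (B.root ())
  ⌜⌝-step⁻¹ {t = app (oplus _ _) _} (B.root ())
  ⌜⌝-step⁻¹ {t = oplus t s} (B.root (⊕₁ _ _)) = t , refl , root (⊕₁ t s)
  ⌜⌝-step⁻¹ {t = oplus t s} (B.root (⊕₂ _ _)) = s , refl , root (⊕₂ t s)
  ⌜⌝-step⁻¹ {t = lam t} (B.lam st) with ⌜⌝-step⁻¹ st
  ... | u , refl , st′ = lam u , refl , lam st′
  ⌜⌝-step⁻¹ {t = app t s} (B.appˡ _ st) with ⌜⌝-step⁻¹ st
  ... | u , refl , st′ = app u s , refl , appˡ s st′
  ⌜⌝-step⁻¹ {t = app t s} (B.appʳ _ (B.bang st)) with ⌜⌝-step⁻¹ st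
  ... | u , refl , st′ = app t u , refl , appʳ t st′
  ⌜⌝-step⁻¹ {t = oplus t s} (B.oplusˡ _ st) with ⌜⌝-step⁻¹ st
  ... | u , refl , st′ = oplus u s , refl , oplusˡ s st′
  ⌜⌝-step⁻¹ {t = oplus t s} (B.oplusʳ _ st) with ⌜⌝-step⁻¹ st
  ... | u , refl , st′ = oplus t u , refl , oplusʳ t st′

  open CbN using (StepVia; stepVia; ctx)
  open LeastLevel Step using (Presentation; least-level-factorization)

  plug-step : ∀ c {r r′} → NRoot r r′ → Step (nlevel c) (plug c r) (plug c r′)
  plug-step hole         ρ = root ρ
  plug-step (lamC c)     ρ = lam (plug-step c ρ)
  plug-step (appR t c)   ρ = appʳ t (plug-step c ρ)
  plug-step (appL c t)   ρ = appˡ t (plug-step c ρ)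
  plug-step (oplusL c t) ρ = oplusˡ t (plug-step c ρ)
  plug-step (oplusR t c) ρ = oplusʳ t (plug-step c ρ)

  step⇒via : Step l t u → Σ (StepVia t u) λ s → nlevel (ctx s) ≡ l
  step⇒via (root ρ) = stepVia hole _ _ ρ refl refl , refl
  step⇒via (lam st)      with step⇒via st
  ... | stepVia c _ _ ρ refl refl , refl = stepVia (lamC c) _ _ ρ refl refl , refl
  step⇒via (appˡ s st)   with step⇒via st
  ... | stepVia c _ _ ρ refl refl , refl = stepVia (appL c s) _ _ ρ refl refl , refl
  step⇒via (appʳ s st)   with step⇒via st
  ... | stepVia c _ _ ρ refl refl , refl = stepVia (appR s c) _ _ ρ refl refl , refl
  step⇒via (oplusˡ s st) with step⇒via st
  ... | stepVia c _ _ ρ refl refl , refl = stepVia (oplusL c s) _ _ ρ refl refl , refl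
  step⇒via (oplusʳ s st) with step⇒via st
  ... | stepVia c _ _ ρ refl refl , refl = stepVia (oplusR s c) _ _ ρ refl refl , refl

  presentation : Presentation
  presentation = record
    { via⇒step = λ { (stepVia c _ _ ρ refl refl) → plug-step c ρ }
    ; step⇒via = step⇒via
    }

  cbn-factorization : CbN.LeastLevelFactorization
  cbn-factorization =
    least-level-factorization presentation (Transfer.factorizes ⌜_⌝ ⌜⌝-injective ⌜⌝-step ⌜⌝-step⁻¹ B.factorizes)

module CbVCalculus where

  open CbNCalculus using (shift-[]; subst-[])

  private variable
    j k l m : ℕ
    a b b′ r r′ s s′ t t′ u v v′ w : Term

  data NonLam : Term → Set where
    var   : ∀ x → NonLam (var x)
    app   : ∀ t s → NonLam (app t s)
    oplus : ∀ t s → NonLam (oplus t s)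

  -- appλ is the context (λx.c)t, whose level is that of c, not one more.
  data Step : ℕ → Term → Term → Set where
    root   : VRoot t u → Step 0 t u
    lam    : Step l t u → Step (suc l) (lam t) (lam u)
    appλ   : ∀ s → Step l t u → Step l (app (lam t) s) (app (lam u) s)
    appˡ   : ∀ s → NonLam t → Step l t u → Step l (app t s) (app u s)
    appʳ   : ∀ s → Step l t u → Step l (app s t) (app s u)
    oplusˡ : ∀ s → Step l t u → Step (suc l) (oplus t s) (oplus u s)
    oplusʳ : ∀ s → Step l t u → Step (suc l) (oplus s t) (oplus s u)

  open LeastLevel Step

  data Par : ℕ → Term → Term → Set where
    var   : ∀ x → Par k (var x) (var x)
    lam   : Par (pred k) t t′ → Par k (lam t) (lam t′)
    appλ  : Par k t t′ → Par k s s′ → Par k (app (lam t) s) (app (lam t′) s′)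
    app   : NonLam t → Par k t t′ → Par k s s′ → Par k (app t s) (app t′ s′)
    oplus : Par (pred k) t t′ → Par (pred k) s s′ → Par k (oplus t s) (oplus t′ s′)
    βv    : Value v → Par 0 t t′ → Par 0 v v′ → Par 0 (app (lam t) v) (t′ [ v′ ])
    ⊕₁    : ∀ s → Par 0 t t′ → Par 0 (oplus t s) t′
    ⊕₂    : ∀ t → Par 0 s s′ → Par 0 (oplus t s) s′

  par-refl : ∀ k t → Par k t t
  par-appʳ : ∀ k t → Par k s s′ → Par k (app t s) (app t s′)
  par-refl k (var x)     = var x
  par-refl k (lam t)     = lam (par-refl (pred k) t)
  par-refl k (app t s)   = par-appʳ k t (par-refl k s)
  par-refl k (oplus t s) = oplus (par-refl (pred k) t) (par-refl (pred k) s)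
  par-appʳ k (var x)     q = app (var x) (var x) q
  par-appʳ k (lam t)     q = appλ (par-refl k t) q
  par-appʳ k (app t u)   q = app (app t u) (par-refl k (app t u)) q
  par-appʳ k (oplus t u) q = app (oplus t u) (par-refl k (oplus t u)) q

  par-suc : Par (suc k) t u → Par k t u
  par-pred : Par k t u → Par (pred k) t u
  par-pred {zero}  par = par
  par-pred {suc k} par = par-suc par
  par-suc (var x)      = var x
  par-suc (lam p)      = lam (par-pred p)
  par-suc (appλ p q)   = appλ (par-suc p) (par-suc q)
  par-suc (app nl p q) = app nl (par-suc p) (par-suc q)
  par-suc (oplus p q)  = oplus (par-pred p) (par-pred q)

  par-antitone : j ≤ k → Par k t u → Par j t u
  par-antitone j≤k = go (≤⇒≤′ j≤k)
    where
    go : j ≤′ k → Par k t u → Par j t u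
    go ≤′-refl        par = par
    go (≤′-step j≤′k) par = go j≤′k (par-suc par)

  step⇒par : Step l t u → Par l t u
  step⇒par (root (βv t v val)) = βv val (par-refl 0 t) (par-refl 0 v)
  step⇒par (root (⊕₁ p q))     = ⊕₁ q (par-refl 0 p)
  step⇒par (root (⊕₂ p q))     = ⊕₂ p (par-refl 0 q)
  step⇒par (lam st)            = lam (step⇒par st)
  step⇒par {l} (appλ s st)     = appλ (step⇒par st) (par-refl l s)
  step⇒par {l} (appˡ s nl st)  = app nl (step⇒par st) (par-refl l s)
  step⇒par {l} (appʳ s st)     = par-appʳ l s (step⇒par st)
  step⇒par {suc l} (oplusˡ s st) = oplus (step⇒par st) (par-refl l s)
  step⇒par {suc l} (oplusʳ s st) = oplus (par-refl l s) (step⇒par st)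

  nonLam-source : Step 0 t u → NonLam t
  nonLam-source (root (βv _ _ _)) = app _ _
  nonLam-source (root (⊕₁ _ _))   = oplus _ _
  nonLam-source (root (⊕₂ _ _))   = oplus _ _
  nonLam-source (appλ _ _)        = app _ _
  nonLam-source (appˡ _ _ _)      = app _ _
  nonLam-source (appʳ _ _)        = app _ _

  step-nonLam : Step (suc l) t u → NonLam t → NonLam u
  step-nonLam (appλ _ _)   _ = app _ _
  step-nonLam (appˡ _ _ _) _ = app _ _
  step-nonLam (appʳ _ _)   _ = app _ _
  step-nonLam (oplusˡ _ _) _ = oplus _ _
  step-nonLam (oplusʳ _ _) _ = oplus _ _

  step-value : Value v → Step l v u → Value u
  step-value (var _) (root ())
  step-value (lam _) (root ())
  step-value (lam _) (lam _) = lam _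

  step-value⁻¹ : Step (suc l) t v → Value v → Value t
  step-value⁻¹ (lam _) (lam _) = lam _

  par-nonLam : Par (suc k) t u → NonLam t → NonLam u
  par-nonLam (var x)     _ = var x
  par-nonLam (appλ _ _)  _ = app _ _
  par-nonLam (app _ _ _) _ = app _ _
  par-nonLam (oplus _ _) _ = oplus _ _

  par-nonLam⁻¹ : Par (suc k) t u → NonLam u → NonLam t
  par-nonLam⁻¹ (var x)     _ = var x
  par-nonLam⁻¹ (appλ _ _)  _ = app _ _
  par-nonLam⁻¹ (app _ _ _) _ = app _ _
  par-nonLam⁻¹ (oplus _ _) _ = oplus _ _

  par-value : Par k v u → Value v → Value u
  par-value (var x) _ = var x
  par-value (lam _) _ = lam _

  par-value⁻¹ : Par (suc k) t v → Value v → Value t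
  par-value⁻¹ (var x) _ = var x
  par-value⁻¹ (lam _) _ = lam _

  shift-value : ∀ c → Value v → Value (shift c v)
  shift-value c (var x) with x <ᵇ c
  ... | true  = var x
  ... | false = var (suc x)
  shift-value c (lam t) = lam _

  shift-nonLam : ∀ c → NonLam t → NonLam (shift c t)
  shift-nonLam c (var x) with x <ᵇ c
  ... | true  = var x
  ... | false = var (suc x)
  shift-nonLam c (app t s)   = app _ _
  shift-nonLam c (oplus t s) = oplus _ _

  shift-step : ∀ c → Step l t u → Step l (shift c t) (shift c u)
  shift-step c (root (βv t v val)) = ≡.subst (Step 0 _) (sym (shift-[] c v t)) (root (βv _ _ (shift-value c val)))
  shift-step c (root (⊕₁ p q))     = root (⊕₁ _ _)
  shift-step c (root (⊕₂ p q))     = root (⊕₂ _ _)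
  shift-step c (lam st)            = lam (shift-step (suc c) st)
  shift-step c (appλ s st)         = appλ _ (shift-step (suc c) st)
  shift-step c (appˡ s nl st)      = appˡ _ (shift-nonLam c nl) (shift-step c st)
  shift-step c (appʳ s st)         = appʳ _ (shift-step c st)
  shift-step c (oplusˡ s st)       = oplusˡ _ (shift-step c st)
  shift-step c (oplusʳ s st)       = oplusʳ _ (shift-step c st)

  shift-par : ∀ c → Par k t u → Par k (shift c t) (shift c u)
  shift-par {k} c (var x)  = par-refl k _
  shift-par c (lam p)      = lam (shift-par (suc c) p)
  shift-par c (appλ p q)   = appλ (shift-par (suc c) p) (shift-par c q)
  shift-par c (app nl p q) = app (shift-nonLam c nl) (shift-par c p) (shift-par c q)
  shift-par c (oplus p q)  = oplus (shift-par c p) (shift-par c q)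
  shift-par c (βv {t′ = t′} {v′ = v′} val p q) =
    ≡.subst (Par 0 _) (sym (shift-[] c v′ t′)) (βv (shift-value c val) (shift-par (suc c) p) (shift-par c q))
  shift-par c (⊕₁ s p)     = ⊕₁ _ (shift-par c p)
  shift-par c (⊕₂ t p)     = ⊕₂ _ (shift-par c p)

  subst-value : ∀ j → Value r → Value v → Value (subst j r v)
  subst-value j val (var x) with x <ᵇ j
  ... | true = var x
  ... | false with x ≡ᵇ j
  ...   | true  = val
  ...   | false = var _
  subst-value j val (lam t) = lam _

  par-app₀ : Par 0 t t′ → Par 0 s s′ → Par 0 (app t s) (app t′ s′)
  par-app₀ (lam p)         q = appλ p q
  par-app₀ p@(var x)       q = app (var x) p q
  par-app₀ p@(appλ _ _)    q = app (app _ _) p q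
  par-app₀ p@(app _ _ _)   q = app (app _ _) p q
  par-app₀ p@(oplus _ _)   q = app (oplus _ _) p q
  par-app₀ p@(βv _ _ _)    q = app (app _ _) p q
  par-app₀ p@(⊕₁ _ _)      q = app (oplus _ _) p q
  par-app₀ p@(⊕₂ _ _)      q = app (oplus _ _) p q

  subst-par : ∀ j → Value r → Par 0 r r′ → Par 0 t t′ → Par 0 (subst j r t) (subst j r′ t′)
  subst-par j val pr (var x) with x <ᵇ j
  ... | true = var x
  ... | false with x ≡ᵇ j
  ...   | true  = pr
  ...   | false = var _
  subst-par j val pr (lam p)      = lam (subst-par (suc j) (shift-value 0 val) (shift-par 0 pr) p)
  subst-par j val pr (appλ p q)   = appλ (subst-par (suc j) (shift-value 0 val) (shift-par 0 pr) p) (subst-par j val pr q)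
  subst-par j val pr (app nl p q) = par-app₀ (subst-par j val pr p) (subst-par j val pr q)
  subst-par j val pr (oplus p q)  = oplus (subst-par j val pr p) (subst-par j val pr q)
  subst-par {r′ = r′} j val pr (βv {t′ = t′} {v′ = v′} valv p q) =
    ≡.subst (Par 0 _) (sym (subst-[] j r′ v′ t′))
      (βv (subst-value j val valv) (subst-par (suc j) (shift-value 0 val) (shift-par 0 pr) p) (subst-par j val pr q))
  subst-par j val pr (⊕₁ s p)     = ⊕₁ _ (subst-par j val pr p)
  subst-par j val pr (⊕₂ t p)     = ⊕₂ _ (subst-par j val pr p)

  subst-step : ∀ j → Value r → Step l t u → Step l (subst j r t) (subst j r u)
  subst-step {r} j val (root (βv t v valv)) =
    ≡.subst (Step 0 _) (sym (subst-[] j r v t)) (root (βv _ _ (subst-value j val valv)))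
  subst-step j val (root (⊕₁ p q))        = root (⊕₁ _ _)
  subst-step j val (root (⊕₂ p q))        = root (⊕₂ _ _)
  subst-step j val (lam st)               = lam (subst-step (suc j) (shift-value 0 val) st)
  subst-step j val (appλ s st)            = appλ _ (subst-step (suc j) (shift-value 0 val) st)
  subst-step j val (appˡ s (var _) (root ()))
  subst-step j val (appˡ s (app _ _) st)  = appˡ _ (app _ _) (subst-step j val st)
  subst-step j val (appˡ s (oplus _ _) st) = appˡ _ (oplus _ _) (subst-step j val st)
  subst-step j val (appʳ s st)            = appʳ _ (subst-step j val st)
  subst-step j val (oplusˡ s st)          = oplusˡ _ (subst-step j val st)
  subst-step j val (oplusʳ s st)          = oplusʳ _ (subst-step j val st)

  Split : ℕ → Term → Term → Set
  Split k t u = ∃[ s ] (Star (Step k) t s × Par (suc k) s u)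

  shift-split : ∀ c → Split 0 t u → Split 0 (shift c t) (shift c u)
  shift-split c (s , sts , p) = shift c s , gmap _ (shift-step c) sts , shift-par c p

  steps-appˡ₀ : ∀ s → Star (Step 0) t u → Star (Step 0) (app t s) (app u s)
  steps-appˡ₀ s = gmap _ λ st → appˡ s (nonLam-source st) st

  split-appλ : Split k t t′ → Split k s s′ → Split k (app (lam t) s) (app (lam t′) s′)
  split-appλ (t₁ , sts , p) (s₁ , sts′ , q) = app (lam t₁) s₁ , gmap _ (appλ _) sts ◅◅ gmap _ (appʳ _) sts′ , appλ p q

  split-app₀ : NonLam t′ → Split 0 t t′ → Split 0 s s′ → Split 0 (app t s) (app t′ s′)
  split-app₀ nl (t₁ , sts , p) (s₁ , sts′ , q) =
    app t₁ s₁ , steps-appˡ₀ _ sts ◅◅ gmap _ (appʳ _) sts′ , app (par-nonLam⁻¹ p nl) p q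

  split-var-app : ∀ x → Split 0 s s′ → Split 0 (app (var x) s) (app (var x) s′)
  split-var-app x (s₁ , sts , q) = app (var x) s₁ , gmap _ (appʳ _) sts , app (var x) (var x) q

  -- A value substituted for a variable in function position may become a β-redex's abstraction;
  -- the split of its body is then needed, so values are split together with their bodies.
  data ValuePar : Term → Term → Set where
    var : ∀ x → ValuePar (var x) (var x)
    lam : Par 0 b b′ → Split 0 b b′ → ValuePar (lam b) (lam b′)

  valuePar-value : ValuePar r r′ → Value r
  valuePar-value (var x)   = var x
  valuePar-value (lam _ _) = lam _

  valuePar⇒par : ValuePar r r′ → Par 0 r r′
  valuePar⇒par (var x)   = var x
  valuePar⇒par (lam p _) = lam p

  shift-valuePar : ∀ c → ValuePar r r′ → ValuePar (shift c r) (shift c r′)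
  shift-valuePar c (var x) with x <ᵇ c
  ... | true  = var x
  ... | false = var (suc x)
  shift-valuePar c (lam p sp) = lam (shift-par (suc c) p) (shift-split (suc c) sp)

  subst-funVar-split : ∀ j x → ValuePar r r′ → Split 0 s s′
                     → Split 0 (app (subst j r (var x)) s) (app (subst j r′ (var x)) s′)
  subst-funVar-split j x vp sp with x <ᵇ j
  ... | true = split-var-app x sp
  ... | false with x ≡ᵇ j
  ...   | false = split-var-app _ sp
  subst-funVar-split j x (var y) sp | false | true = split-var-app y sp
  subst-funVar-split {s = s} j x (lam _ (b₁ , stsb , qb)) (s₁ , sts , q) | false | true =
    app (lam b₁) s₁ , gmap _ (appλ s) stsb ◅◅ gmap _ (appʳ _) sts , appλ qb q

  subst-app-nonLam : ∀ j → Par 1 (app a b) t′ → NonLam (subst j r t′)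
  subst-app-nonLam j (appλ _ _)  = app _ _
  subst-app-nonLam j (app _ _ _) = app _ _

  subst-oplus-nonLam : ∀ j → Par 1 (oplus a b) t′ → NonLam (subst j r t′)
  subst-oplus-nonLam j (oplus _ _) = oplus _ _

  subst-split : ∀ j → Par 1 t t′ → ValuePar r r′ → Split 0 (subst j r t) (subst j r′ t′)
  subst-split j (var x) vp with x <ᵇ j
  ... | true = var x , ε , var x
  ... | false with x ≡ᵇ j
  ...   | false = _ , ε , var _
  subst-split j (var x) (var y)    | false | true = var y , ε , var y
  subst-split j (var x) (lam pb _) | false | true = _ , ε , lam pb
  subst-split j (lam p) vp =
    _ , ε , lam (subst-par (suc j) (shift-value 0 (valuePar-value vp)) (shift-par 0 (valuePar⇒par vp)) p)
  subst-split j (appλ p q) vp = split-appλ (subst-split (suc j) p (shift-valuePar 0 vp)) (subst-split j q vp)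
  subst-split j (app (var x) (var x) q) vp = subst-funVar-split j x vp (subst-split j q vp)
  subst-split j (app (app _ _) p q) vp =
    split-app₀ (subst-app-nonLam j p) (subst-split j p vp) (subst-split j q vp)
  subst-split j (app (oplus _ _) p q) vp =
    split-app₀ (subst-oplus-nonLam j p) (subst-split j p vp) (subst-split j q vp)
  subst-split j (oplus p q) vp =
    _ , ε , oplus (subst-par j (valuePar-value vp) (valuePar⇒par vp) p) (subst-par j (valuePar-value vp) (valuePar⇒par vp) q)

  split-subst : ∀ j → Split 0 t t′ → ValuePar r r′ → Split 0 (subst j r t) (subst j r′ t′)
  split-subst j (t₁ , sts , p) vp with subst-split j p vp
  ... | s , sts′ , q = s , gmap _ (subst-step j (valuePar-value vp)) sts ◅◅ sts′ , q

  -- In function position a split abstraction must keep its body's split: (λx.b)s steps inside b at level 0.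
  data FunPar : Term → Term → Set where
    nonLam : NonLam t → Par 1 t t′ → FunPar t t′
    lam    : Par 0 b b′ → Split 0 b b′ → FunPar (lam b) (lam b′)

  FunSplit : Term → Term → Set
  FunSplit t u = ∃[ s ] (Star (Step 0) t s × FunPar s u)

  funSplit⇒split : FunSplit t u → Split 0 t u
  funSplit⇒split (s , sts , nonLam _ q) = s , sts , q
  funSplit⇒split (s , sts , lam p _)    = s , sts , lam p

  subst-funPar : ∀ j → FunPar t t′ → ValuePar r r′ → FunSplit (subst j r t) (subst j r′ t′)
  subst-funPar j (nonLam (var x) (var x)) vp with x <ᵇ j
  ... | true = var x , ε , nonLam (var x) (var x)
  ... | false with x ≡ᵇ j
  ...   | false = _ , ε , nonLam (var _) (var _)
  subst-funPar j (nonLam (var x) (var x)) (var y)    | false | true = var y , ε , nonLam (var y) (var y)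
  subst-funPar j (nonLam (var x) (var x)) (lam p sp) | false | true = _ , ε , lam p sp
  subst-funPar j (nonLam (app _ _) q) vp with subst-split j q vp
  ... | s , sts , q′ = s , sts , nonLam (par-nonLam⁻¹ q′ (subst-app-nonLam j q)) q′
  subst-funPar j (nonLam (oplus _ _) q) vp with subst-split j q vp
  ... | s , sts , q′ = s , sts , nonLam (par-nonLam⁻¹ q′ (subst-oplus-nonLam j q)) q′
  subst-funPar j (lam p sp) vp =
    _ , ε , lam (subst-par (suc j) (shift-value 0 (valuePar-value vp)) (shift-par 0 (valuePar⇒par vp)) p)
                (split-subst (suc j) sp (shift-valuePar 0 vp))

  par-funSplit₀ : Par 0 t u → FunSplit t u
  par-valuePar : Par 0 v v′ → Value v → ValuePar v v′
  par-valuePar (var x) _ = var x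
  par-valuePar (lam p) _ = lam p (funSplit⇒split (par-funSplit₀ p))
  par-funSplit₀ (var x) = var x , ε , nonLam (var x) (var x)
  par-funSplit₀ (lam {t = t} p) = lam t , ε , lam p (funSplit⇒split (par-funSplit₀ p))
  par-funSplit₀ (appλ p q) with split-appλ (funSplit⇒split (par-funSplit₀ p)) (funSplit⇒split (par-funSplit₀ q))
  ... | s , sts , q′ = s , sts , nonLam (par-nonLam⁻¹ q′ (app _ _)) q′
  par-funSplit₀ (app {s = s} nl p q) with par-funSplit₀ p | funSplit⇒split (par-funSplit₀ q)
  ... | t₁ , sts , nonLam nl₁ p′ | s₁ , sts′ , q′ =
    app t₁ s₁ , steps-appˡ₀ s sts ◅◅ gmap _ (appʳ _) sts′ , nonLam (app _ _) (app nl₁ p′ q′)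
  ... | _ , sts , lam _ (b₁ , stsb , qb) | s₁ , sts′ , q′ =
    app (lam b₁) s₁ , steps-appˡ₀ s sts ◅◅ gmap _ (appλ s) stsb ◅◅ gmap _ (appʳ _) sts′ , nonLam (app _ _) (appλ qb q′)
  par-funSplit₀ (oplus {t = t} {s = s} p q) = oplus t s , ε , nonLam (oplus _ _) (oplus p q)
  par-funSplit₀ (βv {v = v} val p q) with par-funSplit₀ p
  ... | t₁ , sts , fp with subst-funPar 0 fp (par-valuePar q val)
  ...   | s , sts′ , fp′ = s , gmap _ (appλ v) sts ◅◅ root (βv t₁ v val) ◅ sts′ , fp′
  par-funSplit₀ (⊕₁ s p) with par-funSplit₀ p
  ... | r , sts , fp = r , root (⊕₁ _ s) ◅ sts , fp
  par-funSplit₀ (⊕₂ t p) with par-funSplit₀ p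
  ... | r , sts , fp = r , root (⊕₂ t _) ◅ sts , fp

  steps-appˡ : ∀ s → NonLam t → Star (Step (suc k)) t u → Star (Step (suc k)) (app t s) (app u s) × NonLam u
  steps-appˡ s nl ε = ε , nl
  steps-appˡ s nl (st ◅ sts) with steps-appˡ s (step-nonLam st nl) sts
  ... | sts′ , nl′ = appˡ s nl st ◅ sts′ , nl′

  par-split : Par k t u → Split k t u
  par-split {zero} p = funSplit⇒split (par-funSplit₀ p)
  par-split {suc k} (var x) = var x , ε , var x
  par-split {suc k} (lam p) with par-split p
  ... | s , sts , q = lam s , gmap _ lam sts , lam q
  par-split {suc k} (appλ p q) = split-appλ (par-split p) (par-split q)
  par-split {suc k} (app {s = s} nl p q) with par-split p | par-split q
  ... | t₁ , sts , p′ | s₁ , sts′ , q′ with steps-appˡ s nl sts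
  ...   | sts″ , nl₁ = app t₁ s₁ , sts″ ◅◅ gmap _ (appʳ _) sts′ , app nl₁ p′ q′
  par-split {suc k} (oplus p q) with par-split p | par-split q
  ... | t₁ , sts , p′ | s₁ , sts′ , q′ = oplus t₁ s₁ , gmap _ (oplusˡ _) sts ◅◅ gmap _ (oplusʳ _) sts′ , oplus p′ q′

  -- An abstraction in function position does not raise the level, hence the auxiliary depthᶠ.
  depth depthᶠ : Term → ℕ
  depth (var x)     = 0
  depth (lam t)     = suc (depth t)
  depth (app t s)   = depthᶠ t ⊔ depth s
  depth (oplus t s) = suc (depth t ⊔ depth s)
  depthᶠ (lam t)    = depth t
  depthᶠ t@(var _)     = depth t
  depthᶠ t@(app _ _)   = depth t
  depthᶠ t@(oplus _ _) = depth t

  depthᶠ-nonLam : NonLam t → depthᶠ t ≡ depth t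
  depthᶠ-nonLam (var x)     = refl
  depthᶠ-nonLam (app _ _)   = refl
  depthᶠ-nonLam (oplus _ _) = refl

  par-trivial : Par k t u → depth u < k → t ≡ u
  par-trivial (var x) _ = refl
  par-trivial {suc k} (lam p) lt = cong lam (par-trivial p (≤-pred lt))
  par-trivial (appλ {t′ = t′} {s′ = s′} p q) lt =
    cong₂ app (cong lam (par-trivial p (m⊔n<o⇒m<o (depth t′) _ lt))) (par-trivial q (m⊔n<o⇒n<o _ (depth s′) lt))
  par-trivial {suc k} (app {t′ = t′} {s′ = s′} nl p q) lt =
    cong₂ app (par-trivial p (≡.subst (_< suc k) (depthᶠ-nonLam (par-nonLam p nl)) (m⊔n<o⇒m<o (depthᶠ t′) _ lt)))
              (par-trivial q (m⊔n<o⇒n<o _ (depth s′) lt))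
  par-trivial {suc k} (oplus {t′ = t′} {s′ = s′} p q) lt =
    cong₂ oplus (par-trivial p (m⊔n<o⇒m<o (depth t′) _ (≤-pred lt))) (par-trivial q (m⊔n<o⇒n<o _ (depth s′) (≤-pred lt)))

  step-keeps-redexAt : Step l t u → m < l → RedexAt m t → RedexAt m u
  step-keeps-redexAt (appλ _ _)  _ (_ , root (βv _ _ val)) = _ , root (βv _ _ val)
  step-keeps-redexAt (appʳ _ st) _ (_ , root (βv _ _ val)) = _ , root (βv _ _ (step-value val st))
  step-keeps-redexAt (oplusˡ _ _) _ (_ , root (⊕₁ _ _)) = _ , root (⊕₁ _ _)
  step-keeps-redexAt (oplusˡ _ _) _ (_ , root (⊕₂ _ _)) = _ , root (⊕₁ _ _)
  step-keeps-redexAt (oplusʳ _ _) _ (_ , root (⊕₁ _ _)) = _ , root (⊕₁ _ _)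
  step-keeps-redexAt (oplusʳ _ _) _ (_ , root (⊕₂ _ _)) = _ , root (⊕₁ _ _)
  step-keeps-redexAt (lam st) lt (_ , lam st′) = map lam lam (step-keeps-redexAt st (≤-pred lt) (_ , st′))
  step-keeps-redexAt (appλ _ st) lt (_ , appλ _ st′) = map _ (appλ _) (step-keeps-redexAt st lt (_ , st′))
  step-keeps-redexAt (appʳ _ _)  _  (_ , appλ _ st′) = _ , appλ _ st′
  step-keeps-redexAt (appˡ _ () (lam _)) _ (_ , root (βv _ _ _))
  step-keeps-redexAt (appˡ _ () (lam _)) _ (_ , appλ _ _)
  step-keeps-redexAt {l = suc _} (appˡ _ nl st) lt (_ , appˡ _ _ st′) =
    map _ (appˡ _ (step-nonLam st nl)) (step-keeps-redexAt st lt (_ , st′))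
  step-keeps-redexAt (appʳ _ _)  _  (_ , appˡ _ nl st′) = _ , appˡ _ nl st′
  step-keeps-redexAt (appλ _ _)  _  (_ , appʳ _ st′) = _ , appʳ _ st′
  step-keeps-redexAt (appˡ _ _ _) _ (_ , appʳ _ st′) = _ , appʳ _ st′
  step-keeps-redexAt (appʳ _ st) lt (_ , appʳ _ st′) = map _ (appʳ _) (step-keeps-redexAt st lt (_ , st′))
  step-keeps-redexAt (oplusˡ _ st) lt (_ , oplusˡ _ st′) = map _ (oplusˡ _) (step-keeps-redexAt st (≤-pred lt) (_ , st′))
  step-keeps-redexAt (oplusʳ _ _)  _  (_ , oplusˡ _ st′) = _ , oplusˡ _ st′
  step-keeps-redexAt (oplusˡ _ _)  _  (_ , oplusʳ _ st′) = _ , oplusʳ _ st′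
  step-keeps-redexAt (oplusʳ _ st) lt (_ , oplusʳ _ st′) = map _ (oplusʳ _) (step-keeps-redexAt st (≤-pred lt) (_ , st′))

  step-keeps-noRedexBelow : Step l t u → m ≤ l → NoRedexBelow m t → NoRedexBelow m u
  step-keeps-noRedexBelow {m = zero} _ _ _ _ = z≤n
  step-keeps-noRedexBelow {m = suc _} (lam st) (s≤s le) nb (_ , lam st′) =
    s≤s (step-keeps-noRedexBelow st le (s≤s⁻¹ ∘ nb ∘ map lam lam) (_ , st′))
  step-keeps-noRedexBelow (appλ _ _)  _  nb (_ , root (βv _ _ val)) = nb (_ , root (βv _ _ val))
  step-keeps-noRedexBelow (appλ _ st) le nb (_ , appλ _ st′) = step-keeps-noRedexBelow st le (nb ∘ map _ (appλ _)) (_ , st′)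
  step-keeps-noRedexBelow (appλ _ _)  _  nb (_ , appʳ _ st′) = nb (_ , appʳ _ st′)
  step-keeps-noRedexBelow {l = zero} {m = suc _} (appˡ _ _ _) () _ (_ , root (βv _ _ _))
  step-keeps-noRedexBelow {l = zero} {m = suc _} (appˡ _ _ _) () _ (_ , appλ _ _)
  step-keeps-noRedexBelow {l = suc _} (appˡ _ () (lam _)) _ _ (_ , root (βv _ _ _))
  step-keeps-noRedexBelow {l = suc _} (appˡ _ () (lam _)) _ _ (_ , appλ _ _)
  step-keeps-noRedexBelow (appˡ _ nl st) le nb (_ , appˡ _ _ st′) =
    step-keeps-noRedexBelow st le (nb ∘ map _ (appˡ _ nl)) (_ , st′)
  step-keeps-noRedexBelow (appˡ _ _ _) _ nb (_ , appʳ _ st′) = nb (_ , appʳ _ st′)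
  step-keeps-noRedexBelow {l = suc _} (appʳ _ st) _ nb (_ , root (βv _ _ val)) = nb (_ , root (βv _ _ (step-value⁻¹ st val)))
  step-keeps-noRedexBelow (appʳ _ _)  _  nb (_ , appλ _ st′) = nb (_ , appλ _ st′)
  step-keeps-noRedexBelow (appʳ _ _)  _  nb (_ , appˡ _ nl st′) = nb (_ , appˡ _ nl st′)
  step-keeps-noRedexBelow (appʳ _ st) le nb (_ , appʳ _ st′) = step-keeps-noRedexBelow st le (nb ∘ map _ (appʳ _)) (_ , st′)
  step-keeps-noRedexBelow (oplusˡ _ _) _ nb (_ , root (⊕₁ _ _)) = nb (_ , root (⊕₁ _ _))
  step-keeps-noRedexBelow (oplusˡ _ _) _ nb (_ , root (⊕₂ _ _)) = nb (_ , root (⊕₁ _ _))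
  step-keeps-noRedexBelow (oplusʳ _ _) _ nb (_ , root (⊕₁ _ _)) = nb (_ , root (⊕₁ _ _))
  step-keeps-noRedexBelow (oplusʳ _ _) _ nb (_ , root (⊕₂ _ _)) = nb (_ , root (⊕₁ _ _))
  step-keeps-noRedexBelow {m = suc _} (oplusˡ _ st) (s≤s le) nb (_ , oplusˡ _ st′) =
    s≤s (step-keeps-noRedexBelow st le (s≤s⁻¹ ∘ nb ∘ map _ (oplusˡ _)) (_ , st′))
  step-keeps-noRedexBelow (oplusˡ _ _) _ nb (_ , oplusʳ _ st′) = nb (_ , oplusʳ _ st′)
  step-keeps-noRedexBelow (oplusʳ _ _) _ nb (_ , oplusˡ _ st′) = nb (_ , oplusˡ _ st′)
  step-keeps-noRedexBelow {m = suc _} (oplusʳ _ st) (s≤s le) nb (_ , oplusʳ _ st′) =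
    s≤s (step-keeps-noRedexBelow st le (s≤s⁻¹ ∘ nb ∘ map _ (oplusʳ _)) (_ , st′))

  value? : ∀ t → Dec (Value t)
  value? (var x)     = yes (var x)
  value? (lam t)     = yes (lam t)
  value? (app _ _)   = no λ ()
  value? (oplus _ _) = no λ ()

  redexAt? : ∀ k t → Dec (RedexAt k t)
  redexAt? k (var x) = no λ { (_ , root ()) }
  redexAt? zero (lam t) = no λ { (_ , root ()) }
  redexAt? (suc k) (lam t) = map′ (map lam lam) (λ { (_ , lam st) → _ , st }) (redexAt? k t)
  redexAt? zero (app (lam a) s) with value? s | redexAt? zero a | redexAt? zero s
  ... | yes val | _ | _ = yes (_ , root (βv a s val))
  ... | no _ | yes r | _ = yes (map _ (appλ s) r)
  ... | no _ | no _ | yes r = yes (map _ (appʳ _) r)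
  ... | no ¬val | no ¬r | no ¬r′ =
    no λ { (_ , root (βv _ _ val)) → ¬val val ; (_ , appλ _ st) → ¬r (_ , st) ; (_ , appˡ _ () _) ; (_ , appʳ _ st) → ¬r′ (_ , st) }
  redexAt? (suc k) (app (lam a) s) with redexAt? (suc k) a | redexAt? (suc k) s
  ... | yes r | _ = yes (map _ (appλ s) r)
  ... | no _ | yes r = yes (map _ (appʳ _) r)
  ... | no ¬r | no ¬r′ = no λ { (_ , appλ _ st) → ¬r (_ , st) ; (_ , appˡ _ () _) ; (_ , appʳ _ st) → ¬r′ (_ , st) }
  redexAt? k (app (var x) s) = map′ (map _ (appʳ _)) (λ { (_ , appˡ _ _ (root ())) ; (_ , appʳ _ st) → _ , st }) (redexAt? k s)
  redexAt? k (app t@(app _ _) s) with redexAt? k t | redexAt? k s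
  ... | yes r | _ = yes (map _ (appˡ s (app _ _)) r)
  ... | no _ | yes r = yes (map _ (appʳ _) r)
  ... | no ¬r | no ¬r′ = no λ { (_ , appˡ _ _ st) → ¬r (_ , st) ; (_ , appʳ _ st) → ¬r′ (_ , st) }
  redexAt? k (app t@(oplus _ _) s) with redexAt? k t | redexAt? k s
  ... | yes r | _ = yes (map _ (appˡ s (oplus _ _)) r)
  ... | no _ | yes r = yes (map _ (appʳ _) r)
  ... | no ¬r | no ¬r′ = no λ { (_ , appˡ _ _ st) → ¬r (_ , st) ; (_ , appʳ _ st) → ¬r′ (_ , st) }
  redexAt? zero (oplus t s) = yes (_ , root (⊕₁ t s))
  redexAt? (suc k) (oplus t s) with redexAt? k t | redexAt? k s
  ... | yes r | _ = yes (map _ (oplusˡ s) r)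
  ... | no _ | yes r = yes (map _ (oplusʳ t) r)
  ... | no ¬r | no ¬r′ = no λ { (_ , oplusˡ _ st) → ¬r (_ , st) ; (_ , oplusʳ _ st) → ¬r′ (_ , st) }

  stepFrom₀-appˡ : ∀ s → StepFrom 0 t u → StepFrom 0 (app t s) (app u s)
  stepFrom₀-appˡ {var _} s (_ , _ , root ())
  stepFrom₀-appˡ {lam _} s (_ , _ , root ())
  stepFrom₀-appˡ {lam _} s (_ , _ , lam st) = _ , z≤n , appλ s st
  stepFrom₀-appˡ {app _ _} s (l , le , st) = l , le , appˡ s (app _ _) st
  stepFrom₀-appˡ {oplus _ _} s (l , le , st) = l , le , appˡ s (oplus _ _) st

  stepsFrom-appˡ : ∀ s → NonLam t → Star (StepFrom (suc k)) t u → Star (StepFrom (suc k)) (app t s) (app u s)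
  stepsFrom-appˡ s nl ε = ε
  stepsFrom-appˡ s nl ((suc l , le , st) ◅ sts) = (suc l , le , appˡ s nl st) ◅ stepsFrom-appˡ s (step-nonLam st nl) sts

  par⇒steps : Par k t u → Star (StepFrom k) t u
  par⇒steps (var x)     = ε
  par⇒steps (lam p)     = stepsFrom-map suc pred≤⇒≤suc lam (par⇒steps p)
  par⇒steps (appλ p q)  = stepsFrom-map id id (appλ _) (par⇒steps p) ◅◅ stepsFrom-map id id (appʳ _) (par⇒steps q)
  par⇒steps {zero} (app _ p q) = gmap _ (stepFrom₀-appˡ _) (par⇒steps p) ◅◅ stepsFrom-map id id (appʳ _) (par⇒steps q)
  par⇒steps {suc k} (app nl p q) = stepsFrom-appˡ _ nl (par⇒steps p) ◅◅ stepsFrom-map id id (appʳ _) (par⇒steps q)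
  par⇒steps (oplus p q) =
    stepsFrom-map suc pred≤⇒≤suc (oplusˡ _) (par⇒steps p) ◅◅ stepsFrom-map suc pred≤⇒≤suc (oplusʳ _) (par⇒steps q)
  par⇒steps (βv {t′ = t′} {v′ = v′} val p q) =
    stepsFrom-map id id (appλ _) (par⇒steps p) ◅◅ stepsFrom-map id (λ _ → z≤n) (appʳ _) (par⇒steps q)
    ◅◅ (0 , z≤n , root (βv t′ v′ (par-value q val))) ◅ ε
  par⇒steps (⊕₁ s p) = (0 , z≤n , root (⊕₁ _ s)) ◅ par⇒steps p
  par⇒steps (⊕₂ t p) = (0 , z≤n , root (⊕₂ t _)) ◅ par⇒steps p

  par-merge : Par (suc k) t u → Step k u w → Par k t w
  par-merge (appλ p q)   (root (βv _ _ val)) = βv (par-value⁻¹ q val) (par-suc p) (par-suc q)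
  par-merge (app () (lam _) _) (root (βv _ _ _))
  par-merge (oplus p q)  (root (⊕₁ _ _)) = ⊕₁ _ p
  par-merge (oplus p q)  (root (⊕₂ _ _)) = ⊕₂ _ q
  par-merge (lam p)      (lam st)        = lam (par-merge p st)
  par-merge (appλ p q)   (appλ _ st)     = appλ (par-merge p st) (par-suc q)
  par-merge (app () (lam _) _) (appλ _ _)
  par-merge (app nl p q) (appˡ _ _ st)   = app nl (par-merge p st) (par-suc q)
  par-merge (appλ p q)   (appʳ _ st)     = appλ (par-suc p) (par-merge q st)
  par-merge (app nl p q) (appʳ _ st)     = app nl (par-suc p) (par-merge q st)
  par-merge (oplus p q)  (oplusˡ _ st)   = oplus (par-merge p st) (par-suc q)
  par-merge (oplus p q)  (oplusʳ _ st)   = oplus (par-suc p) (par-merge q st)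

  macroSteps : MacroSteps
  macroSteps = record
    { Par                     = Par
    ; depth                   = depth
    ; redexAt?                = redexAt?
    ; step-keeps-redexAt      = step-keeps-redexAt
    ; step-keeps-noRedexBelow = step-keeps-noRedexBelow
    ; step⇒par                = step⇒par
    ; par-antitone            = par-antitone
    ; par⇒steps               = par⇒steps
    ; par-trivial             = par-trivial
    ; par-split               = par-split
    ; par-merge               = par-merge
    }

  open CbV using (StepVia; stepVia; ctx)

  root-nonLam : VRoot t u → NonLam t
  root-nonLam (βv _ _ _) = app _ _
  root-nonLam (⊕₁ _ _)   = oplus _ _
  root-nonLam (⊕₂ _ _)   = oplus _ _

  plug-step : ∀ c {r r′} → VRoot r r′ → Step (vlevel c) (plug c r) (plug c r′)
  plug-step hole                  ρ = root ρ
  plug-step (lamC c)              ρ = lam (plug-step c ρ)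
  plug-step (appR t c)            ρ = appʳ t (plug-step c ρ)
  plug-step (appL (lamC c) t)     ρ = appλ t (plug-step c ρ)
  plug-step (appL hole t)         ρ = appˡ t (root-nonLam ρ) (root ρ)
  plug-step (appL c@(appR _ _) t)   ρ = appˡ t (app _ _) (plug-step c ρ)
  plug-step (appL c@(appL _ _) t)   ρ = appˡ t (app _ _) (plug-step c ρ)
  plug-step (appL c@(oplusL _ _) t) ρ = appˡ t (oplus _ _) (plug-step c ρ)
  plug-step (appL c@(oplusR _ _) t) ρ = appˡ t (oplus _ _) (plug-step c ρ)
  plug-step (oplusL c t)          ρ = oplusˡ t (plug-step c ρ)
  plug-step (oplusR t c)          ρ = oplusʳ t (plug-step c ρ)

  vlevel-appL : ∀ c {r} s → NonLam (plug c r) → vlevel (appL c s) ≡ vlevel c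
  vlevel-appL hole         s _ = refl
  vlevel-appL (appR _ _)   s _ = refl
  vlevel-appL (appL _ _)   s _ = refl
  vlevel-appL (oplusL _ _) s _ = refl
  vlevel-appL (oplusR _ _) s _ = refl

  step⇒via : Step l t u → Σ (StepVia t u) λ s → vlevel (ctx s) ≡ l
  step⇒via (root ρ) = stepVia hole _ _ ρ refl refl , refl
  step⇒via (lam st)      with step⇒via st
  ... | stepVia c _ _ ρ refl refl , refl = stepVia (lamC c) _ _ ρ refl refl , refl
  step⇒via (appλ s st)   with step⇒via st
  ... | stepVia c _ _ ρ refl refl , refl = stepVia (appL (lamC c) s) _ _ ρ refl refl , refl
  step⇒via (appˡ s nl st) with step⇒via st
  ... | stepVia c _ _ ρ refl refl , refl = stepVia (appL c s) _ _ ρ refl refl , vlevel-appL c s nl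
  step⇒via (appʳ s st)   with step⇒via st
  ... | stepVia c _ _ ρ refl refl , refl = stepVia (appR s c) _ _ ρ refl refl , refl
  step⇒via (oplusˡ s st) with step⇒via st
  ... | stepVia c _ _ ρ refl refl , refl = stepVia (oplusL c s) _ _ ρ refl refl , refl
  step⇒via (oplusʳ s st) with step⇒via st
  ... | stepVia c _ _ ρ refl refl , refl = stepVia (oplusR s c) _ _ ρ refl refl , refl

  presentation : Presentation
  presentation = record
    { via⇒step = λ { (stepVia c _ _ ρ refl refl) → plug-step c ρ }
    ; step⇒via = step⇒via
    }

  cbv-factorization : CbV.LeastLevelFactorization
  cbv-factorization = least-level-factorization presentation (Factorization.factorizes macroSteps)

theorem5 : Bang.LeastLevelFactorization × (CbN.LeastLevelFactorization × CbV.LeastLevelFactorization)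
theorem5 = BangCalculus.bang-factorization , CbNCalculus.cbn-factorization , CbVCalculus.cbv-factorization
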